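{- Let $\ell\ge2$ and $n_1,\dots,n_\ell$ be positive integers such that at least two of them are odd, and suppose (after relabeling) that $n_1$ and $n_2$ are the two smallest odd numbers among $n_1,\dots,n_\ell$. Then $$\gamma_{\rm SMB}'(S(n_1,\dots,n_\ell))=\lceil \log_2(n_1+n_2+1)\rceil.$$
   Context: $S(n_1,\dots,n_\ell)$ is the subdivided star obtained from paths $P_{n_1},\dots,P_{n_\ell}$ and a new central vertex $x$ by making $x$ adjacent to one end of each path. The Maker-Breaker domination game on a finite simple graph $G$: Dominator and Staller alternately claim previously unclaimed vertices of $G$. Staller wins if she claims all vertices of the closed neighborhood $N_G[v]$ of some vertex $v$; otherwise Dominator wins. In the S-game Staller moves first. $\gamma_{\rm SMB}'(G)$ is the minimum number of moves Staller needs to win the S-game under optimal play (Staller minimizing the number of her moves, Dominator trying to prevent or delay her win), $\infty$ if Staller has no winning strategy. -}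

module Defs where

open import Data.Nat using (ℕ; zero; suc; _+_; _*_; _≤_)
open import Data.Fin using (Fin; toℕ)
open import Data.List using (List; _∷_; [])
open import Data.List.Membership.Propositional using (_∈_; _∉_)
open import Data.Product using (Σ; ∃; _×_; _,_)
open import Data.Sum using (_⊎_)
open import Data.Empty using (⊥)
open import Relation.Binary.PropositionalEquality using (_≡_)

record Graph : Set₁ where
  field
    V   : Set
    Adj : V → V → Set

module _ (G : Graph) where
  open Graph G

  InClosedNbhd : V → V → Set
  InClosedNbhd v u = u ≡ v ⊎ Adj v u

  Free : V → List V → List V → Set
  Free v S D = v ∉ S × v ∉ D

  StallerWon : List V → Set
  StallerWon S = ∃ λ v → ∀ u → InClosedNbhd v u → u ∈ S

  -- StallerWinsWithin k S D : in position (S = Staller's vertices, D =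
  -- Dominator's vertices) with Staller to move, Staller has a strategy
  -- guaranteeing she wins having played at most k further moves,
  -- whatever Dominator does.  If the board is exhausted after Staller's
  -- move and she has not won, the game is over and Dominator has won.
  StallerWinsWithin : ℕ → List V → List V → Set
  StallerWinsWithin zero    S D = ⊥
  StallerWinsWithin (suc k) S D =
    ∃ λ v → Free v S D ×
      (StallerWon (v ∷ S) ⊎
        ((∃ λ u → Free u (v ∷ S) D) ×
         (∀ u → Free u (v ∷ S) D → StallerWinsWithin k (v ∷ S) (u ∷ D))))

  γ'SMB≡ : ℕ → Set
  γ'SMB≡ c = StallerWinsWithin c [] [] × (∀ k → StallerWinsWithin k [] [] → c ≤ k)

-- Subdivided star S(n_1,...,n_ℓ): centre x, and leg i is the path
-- leg i 0 - leg i 1 - ... - leg i (n_i - 1), with leg i 0 adjacent to x.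
data StarV (ℓ : ℕ) (n : Fin ℓ → ℕ) : Set where
  centre : StarV ℓ n
  leg    : (i : Fin ℓ) → Fin (n i) → StarV ℓ n

data StarAdj (ℓ : ℕ) (n : Fin ℓ → ℕ) : StarV ℓ n → StarV ℓ n → Set where
  cx : ∀ i (j : Fin (n i)) → toℕ j ≡ 0 → StarAdj ℓ n centre (leg i j)
  xc : ∀ i (j : Fin (n i)) → toℕ j ≡ 0 → StarAdj ℓ n (leg i j) centre
  up : ∀ i (j j' : Fin (n i)) → toℕ j' ≡ suc (toℕ j) → StarAdj ℓ n (leg i j) (leg i j')
  dn : ∀ i (j j' : Fin (n i)) → toℕ j' ≡ suc (toℕ j) → StarAdj ℓ n (leg i j') (leg i j)

SubdividedStar : (ℓ : ℕ) → (Fin ℓ → ℕ) → Graph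
SubdividedStar ℓ n = record { V = StarV ℓ n ; Adj = StarAdj ℓ n }

Odd : ℕ → Set
Odd m = ∃ λ k → m ≡ suc (2 * k)

-- The two shortest odd legs and the centre form a path P of N = n₁ + n₂ + 1 vertices
-- whose even-position vertices are leg vertices, so their closed neighbourhoods lie on P.  Staller
-- keeps a free segment of odd length 2r + 1, starting at an even position, whose outside neighbours
-- on P she owns: she claims its middle odd-position vertex and continues in the half Dominator did
-- not touch.  A one-vertex segment is an immediate win, so r < 2ʲ gives a win in j + 1 moves.
--
-- Dominator keeps every vertex he has not dominated inside disjoint unclaimed
-- structures: adjacent pairs, and spiders (a centre with paths as legs) any two of whose legs
-- together have at least B - 2 vertices.  While B ≥ 3 no closed neighbourhood inside a structure
-- can be completed in one move, and Dominator can answer every Staller move so that the structures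
-- survive with B replaced by ⌈B/2⌉: in a pair he takes the partner; in a spider he claims the
-- neighbour of Staller's vertex on the side that keeps half of the bound, pairing up what is cut
-- off.  Initially the odd legs form a spider with B = n₁ + n₂ + 2 and the even legs are paired up,
-- so Staller needs at least log₂ N moves.
module Submission where

open import Defs
open import Data.Bool using (if_then_else_)
open import Data.Fin as Fin using (Fin; toℕ; fromℕ<; opposite)
import Data.Fin.Properties as Fin
open import Data.List
  using (List; []; _∷_; [_]; _++_; _∷ʳ_; concat; concatMap; length; reverse; _ʳ++_; filter; tabulate;
         initLast; _∷ʳ′_)
import Data.List.Properties as List
open import Data.List.Membership.Propositional using (_∈_; _∉_)
open import Data.List.Membership.Propositional.Properties
  using (∈-++⁺ˡ; ∈-++⁺ʳ; ∈-++⁻; ∈-∃++; ∈-length; ∈-concat⁻′; ∈-concat⁺′; ∈-map⁺;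
         ∈-tabulate⁺; ∈-tabulate⁻; ∈-filter⁺; ∈-filter⁻)
open import Data.List.Relation.Binary.Disjoint.Propositional using (Disjoint)
open import Data.List.Relation.Binary.Permutation.Propositional
  using (_↭_; ↭-refl; ↭-sym; ↭-trans; ↭-reflexive; ↭-isEquivalence; prep; swap;
         module PermutationReasoning)
import Data.List.Relation.Binary.Permutation.Propositional.Properties as Perm
open import Data.List.Relation.Unary.All as All using (All; []; _∷_)
import Data.List.Relation.Unary.All.Properties as All
open import Data.List.Relation.Unary.AllPairs as AllPairs using (AllPairs; []; _∷_)
import Data.List.Relation.Unary.AllPairs.Properties as AllPairs
open import Data.List.Relation.Unary.Any using (here; there)
import Data.List.Relation.Unary.Any.Properties as Any
open import Data.List.Relation.Unary.Linked as Linked using (Linked; []; [-]; _∷_)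
open import Data.List.Relation.Unary.Unique.Propositional using (Unique)
import Data.List.Relation.Unary.Unique.Propositional.Properties as Unique
open import Data.Nat
  using (ℕ; zero; suc; _+_; _*_; _^_; _∸_; _≤_; _<_; z≤n; s≤s; ⌈_/2⌉; ⌊_/2⌋; _≤?_; _<?_)
open import Data.Nat.Induction using (<-rec)
open import Data.Nat.Logarithm
  using (⌈log₂_⌉; ⌈log₂⌉-mono-≤; ⌈log₂2^n⌉≡n; ⌈log₂⌈n/2⌉⌉≡⌈log₂n⌉∸1)
open import Data.Nat.Properties hiding (_≟_)
open import Data.Nat.Tactic.RingSolver using (solve-∀)
open import Data.Product using (∃; ∃₂; _×_; _,_; proj₁; proj₂)
open import Data.Sum using (_⊎_; inj₁; inj₂; [_,_]′; map₁; map₂)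
open import Data.Unit using (⊤; tt)
open import Function using (_∘_; flip)
open import Relation.Binary.Bundles using (Preorder)
open import Relation.Binary.Definitions using (DecidableEquality; Symmetric)
open import Relation.Binary.PropositionalEquality
  using (_≡_; _≢_; refl; sym; trans; cong; cong₂; subst; subst₂; module ≡-Reasoning)
import Relation.Binary.Reasoning.Preorder
open import Relation.Nullary using (¬_; Dec; yes; no; does; contradiction; _×-dec_)
import Relation.Unary
open import Relation.Unary.Properties using (∁?)

module Bags {A : Set} (_≟_ : DecidableEquality A) where

  indicator : A → A → ℕ
  indicator x y = if does (x ≟ y) then 1 else 0

  count : A → List A → ℕ
  count x [] = 0
  count x (y ∷ ys) = indicator x y + count x ys

  count-++ : ∀ x xs {ys} → count x (xs ++ ys) ≡ count x xs + count x ys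
  count-++ x [] = refl
  count-++ x (y ∷ xs) {ys} =
    trans (cong (indicator x y +_) (count-++ x xs)) (sym (+-assoc (indicator x y) (count x xs) (count x ys)))

  count-resp-↭ : ∀ {x xs ys} → xs ↭ ys → count x xs ≡ count x ys
  count-resp-↭ _↭_.refl = refl
  count-resp-↭ {x} (prep y p) = cong (indicator x y +_) (count-resp-↭ p)
  count-resp-↭ {x} (swap y z p) =
    trans (cong (λ n → indicator x y + (indicator x z + n)) (count-resp-↭ p))
          (+-exchange (indicator x y) (indicator x z) _)
    where
    +-exchange : ∀ a b c → a + (b + c) ≡ b + (a + c)
    +-exchange = solve-∀
  count-resp-↭ (_↭_.trans p q) = trans (count-resp-↭ p) (count-resp-↭ q)

  ∈⇒count-pos : ∀ {x xs} → x ∈ xs → 1 ≤ count x xs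
  ∈⇒count-pos {x} {y ∷ ys} x∈ with x ≟ y | x∈
  ... | yes _ | _ = s≤s z≤n
  ... | no x≢y | here x≡y = contradiction x≡y x≢y
  ... | no _ | there x∈ys = ∈⇒count-pos x∈ys

  count-pos⇒∈ : ∀ {x} xs → 1 ≤ count x xs → x ∈ xs
  count-pos⇒∈ {x} (y ∷ ys) pos with x ≟ y
  ... | yes x≡y = here x≡y
  ... | no _ = there (count-pos⇒∈ ys pos)

  count-∉ : ∀ {x} xs → x ∉ xs → count x xs ≡ 0
  count-∉ [] _ = refl
  count-∉ {x} (y ∷ ys) x∉ with x ≟ y
  ... | yes x≡y = contradiction (here x≡y) x∉
  ... | no _ = count-∉ ys (x∉ ∘ there)

  infix 4 _⊑_

  record _⊑_ (xs ys : List A) : Set where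
    constructor count-≤
    field count≤ : ∀ x → count x xs ≤ count x ys
  open _⊑_

  ↭⇒⊑ : ∀ {xs ys} → xs ↭ ys → xs ⊑ ys
  ↭⇒⊑ p = count-≤ λ x → ≤-reflexive (count-resp-↭ p)

  ⊑-trans : ∀ {xs ys zs} → xs ⊑ ys → ys ⊑ zs → xs ⊑ zs
  ⊑-trans p q = count-≤ λ x → ≤-trans (count≤ p x) (count≤ q x)

  ⊑-preorder : Preorder _ _ _
  ⊑-preorder = record
    { Carrier = List A
    ; _≈_ = _↭_
    ; _≲_ = _⊑_
    ; isPreorder = record { isEquivalence = ↭-isEquivalence ; reflexive = ↭⇒⊑ ; trans = ⊑-trans }
    }

  module ⊑-Reasoning = Relation.Binary.Reasoning.Preorder ⊑-preorder

  ⊑-refl : ∀ {xs} → xs ⊑ xs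
  ⊑-refl = count-≤ λ x → ≤-refl

  []⊑ : ∀ {xs} → [] ⊑ xs
  []⊑ = count-≤ λ x → z≤n

  ∈-resp-⊑ : ∀ {x xs ys} → xs ⊑ ys → x ∈ xs → x ∈ ys
  ∈-resp-⊑ {x} {ys = ys} xs⊑ys x∈xs =
    count-pos⇒∈ ys (≤-trans (∈⇒count-pos x∈xs) (count≤ xs⊑ys x))

  ⊑-++⁺ : ∀ {xs ys us vs} → xs ⊑ ys → us ⊑ vs → xs ++ us ⊑ ys ++ vs
  ⊑-++⁺ {xs} {ys} {us} {vs} p q = count-≤ λ x →
    subst₂ _≤_ (sym (count-++ x xs)) (sym (count-++ x ys)) (+-mono-≤ (count≤ p x) (count≤ q x))

  ⊑-++⁺ʳ : ∀ {xs ys} zs → xs ⊑ ys → xs ++ zs ⊑ ys ++ zs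
  ⊑-++⁺ʳ zs p = ⊑-++⁺ p ⊑-refl

  ⊑-++⁺ˡ : ∀ xs {ys zs} → ys ⊑ zs → xs ++ ys ⊑ xs ++ zs
  ⊑-++⁺ˡ xs p = ⊑-++⁺ (⊑-refl {xs}) p

  xs⊑xs++ys : ∀ xs {ys} → xs ⊑ xs ++ ys
  xs⊑xs++ys xs {ys} = count-≤ λ x → subst (count x xs ≤_) (sym (count-++ x xs)) (m≤m+n _ _)

  ys⊑xs++ys : ∀ xs {ys} → ys ⊑ xs ++ ys
  ys⊑xs++ys xs {ys} = count-≤ λ x → subst (count x ys ≤_) (sym (count-++ x xs)) (m≤n+m _ _)

  Distinct : List A → Set
  Distinct xs = ∀ x → count x xs ≤ 1

  Distinct-⊑ : ∀ {xs ys} → xs ⊑ ys → Distinct ys → Distinct xs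
  Distinct-⊑ p d x = ≤-trans (count≤ p x) (d x)

  Distinct-++ : ∀ {x} xs {ys} → Distinct (xs ++ ys) → x ∈ xs → x ∉ ys
  Distinct-++ {x} xs {ys} d x∈xs x∈ys with ≤-trans (+-mono-≤ (∈⇒count-pos x∈xs) (∈⇒count-pos x∈ys))
                                                 (subst (_≤ 1) (count-++ x xs) (d x))
  ... | s≤s ()

  Unique⇒Distinct : ∀ {xs} → Unique xs → Distinct xs
  Unique⇒Distinct [] x = z≤n
  Unique⇒Distinct {y ∷ ys} (y∉ ∷ u) x with x ≟ y
  ... | no _ = Unique⇒Distinct u x
  ... | yes refl = s≤s (≤-reflexive (count-∉ ys (λ x∈ → All.lookup y∉ x∈ refl)))

module _ {A : Set} {R : A → A → Set} where

  linked-++⁻ˡ : ∀ xs {ys} → Linked R (xs ++ ys) → Linked R xs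
  linked-++⁻ˡ [] _ = []
  linked-++⁻ˡ (x ∷ []) _ = [-]
  linked-++⁻ˡ (x ∷ y ∷ xs) (r ∷ l) = r ∷ linked-++⁻ˡ (y ∷ xs) l

  linked-++⁻ʳ : ∀ xs {ys} → Linked R (xs ++ ys) → Linked R ys
  linked-++⁻ʳ [] l = l
  linked-++⁻ʳ (x ∷ xs) l = linked-++⁻ʳ xs (Linked.tail l)

  linked-middle : ∀ xs {a b ys} → Linked R (xs ++ a ∷ b ∷ ys) → R a b
  linked-middle xs l = Linked.head (linked-++⁻ʳ xs l)

  linked-predecessor : ∀ {x xs y} → Linked R (x ∷ xs) → y ∈ xs → ∃ λ p → p ∈ x ∷ xs × R p y
  linked-predecessor (r ∷ _) (here refl) = _ , here refl , r
  linked-predecessor (_ ∷ l) (there y∈) with linked-predecessor l y∈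
  ... | p , p∈ , r = p , there p∈ , r

  ʳ++-linked : ∀ {y} xs {ys} → Linked (flip R) (y ∷ xs) → Linked R (y ∷ ys) → Linked R (xs ʳ++ y ∷ ys)
  ʳ++-linked [] _ l = l
  ʳ++-linked (x ∷ xs) (r ∷ lxs) l = ʳ++-linked xs lxs (r ∷ l)

  tabulate-linked : ∀ {m} (g : Fin m → A) → (∀ a b → toℕ b ≡ suc (toℕ a) → R (g a) (g b)) →
                    Linked R (tabulate g)
  tabulate-linked {zero} g _ = []
  tabulate-linked {suc zero} g _ = [-]
  tabulate-linked {suc (suc m)} g step =
    step Fin.zero (Fin.suc Fin.zero) refl ∷
    tabulate-linked (g ∘ Fin.suc) (λ a b b≡ → step (Fin.suc a) (Fin.suc b) (cong suc b≡))

  ∷-tabulate-linked : ∀ {m} x (g : Fin m → A) → (∀ a → toℕ a ≡ 0 → R x (g a)) →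
                      (∀ a b → toℕ b ≡ suc (toℕ a) → R (g a) (g b)) → Linked R (x ∷ tabulate g)
  ∷-tabulate-linked {zero} x g _ _ = [-]
  ∷-tabulate-linked {suc m} x g first step = first Fin.zero refl ∷ tabulate-linked g step

  AllPairs-resp-↭ : Symmetric R → ∀ {xs ys} → xs ↭ ys → AllPairs R xs → AllPairs R ys
  AllPairs-resp-↭ sym _↭_.refl ps = ps
  AllPairs-resp-↭ sym (prep x p) (px ∷ ps) = Perm.All-resp-↭ p px ∷ AllPairs-resp-↭ sym p ps
  AllPairs-resp-↭ sym (swap x y p) ((rxy ∷ px) ∷ py ∷ ps) =
    (sym rxy ∷ Perm.All-resp-↭ p py) ∷ Perm.All-resp-↭ p px ∷ AllPairs-resp-↭ sym p ps
  AllPairs-resp-↭ sym (_↭_.trans p q) ps = AllPairs-resp-↭ sym q (AllPairs-resp-↭ sym p ps)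

module _ {A : Set} where

  ∈⇒↭∷ : ∀ {x : A} {xs} → x ∈ xs → ∃ λ ys → xs ↭ x ∷ ys
  ∈⇒↭∷ {x} x∈ with ∈-∃++ x∈
  ... | ys , zs , refl = ys ++ zs , Perm.shift x ys zs

  concat-↭ : ∀ {xss yss : List (List A)} → xss ↭ yss → concat xss ↭ concat yss
  concat-↭ _↭_.refl = ↭-refl
  concat-↭ (prep xs p) = Perm.++⁺ˡ xs (concat-↭ p)
  concat-↭ (swap xs ys p) = ↭-trans (Perm.shifts xs ys) (Perm.++⁺ˡ ys (Perm.++⁺ˡ xs (concat-↭ p)))
  concat-↭ (_↭_.trans p q) = ↭-trans (concat-↭ p) (concat-↭ q)

  two-members : ∀ {a b : A} {xs} → a ∈ xs → b ∈ xs → a ≢ b → 2 ≤ length xs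
  two-members (here refl) (here refl) a≢b = contradiction refl a≢b
  two-members (here refl) (there b∈) _ = s≤s (∈-length b∈)
  two-members (there a∈) _ _ = s≤s (∈-length a∈)

  ShorterOrEmpty : List A → List A → Set
  ShorterOrEmpty xs ys = ys ≡ [] ⊎ length xs ≤ length ys

  shortestNonEmpty : ∀ (xss : List (List A)) →
    All (_≡ []) xss ⊎
    ∃₂ λ h t → ∃ λ others → xss ↭ (h ∷ t) ∷ others × All (ShorterOrEmpty (h ∷ t)) others
  shortestNonEmpty [] = inj₁ []
  shortestNonEmpty (xs ∷ xss) with shortestNonEmpty xss
  shortestNonEmpty ([] ∷ xss) | inj₁ empty = inj₁ (refl ∷ empty)
  shortestNonEmpty ((h ∷ t) ∷ xss) | inj₁ empty = inj₂ (h , t , xss , ↭-refl , All.map inj₁ empty)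
  shortestNonEmpty ([] ∷ xss) | inj₂ (h , t , others , p , shorter) =
    inj₂ (h , t , [] ∷ others , ↭-trans (prep [] p) (swap [] (h ∷ t) ↭-refl) , inj₁ refl ∷ shorter)
  shortestNonEmpty (xs@(h′ ∷ t′) ∷ xss) | inj₂ (h , t , others , p , shorter) with length t ≤? length t′
  ... | yes t≤t′ =
    inj₂ (h , t , xs ∷ others , ↭-trans (prep xs p) (swap xs (h ∷ t) ↭-refl) ,
          inj₂ (s≤s t≤t′) ∷ shorter)
  ... | no t≰t′ =
    inj₂ (h′ , t′ , (h ∷ t) ∷ others , prep xs p , inj₂ xs≤ht ∷ All.map shorter-trans shorter)
    where
    xs≤ht : length xs ≤ length (h ∷ t)
    xs≤ht = s≤s (≤-trans (n≤1+n _) (≰⇒> t≰t′))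
    shorter-trans : ∀ {ys} → ShorterOrEmpty (h ∷ t) ys → ShorterOrEmpty xs ys
    shorter-trans (inj₁ ys≡[]) = inj₁ ys≡[]
    shorter-trans (inj₂ ht≤ys) = inj₂ (≤-trans xs≤ht ht≤ys)

module _ {A : Set} {P : A → Set} (P? : Relation.Unary.Decidable P) where

  filter-partition-↭ : ∀ xs → filter P? xs ++ filter (∁? P?) xs ↭ xs
  filter-partition-↭ [] = ↭-refl
  filter-partition-↭ (x ∷ xs) with P? x
  ... | yes _ = prep x (filter-partition-↭ xs)
  ... | no _ = ↭-trans (Perm.shift x (filter P? xs) _) (prep x (filter-partition-↭ xs))

  AllPairs-filter : ∀ {R : A → A → Set} {xs} → AllPairs (λ a b → P a → P b → R a b) xs →
                    AllPairs R (filter P? xs)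
  AllPairs-filter {R} {xs} rs = discharge (All.all-filter P? xs) (AllPairs.filter⁺ P? rs)
    where
    discharge : ∀ {ys} → All P ys → AllPairs (λ a b → P a → P b → R a b) ys → AllPairs R ys
    discharge [] [] = []
    discharge (pa ∷ pas) (ras ∷ rs) = All.zipWith (λ (r , pb) → r pa pb) (ras , pas) ∷ discharge pas rs

m≤n+n⇒⌈m/2⌉≤n : ∀ {m n} → m ≤ n + n → ⌈ m /2⌉ ≤ n
m≤n+n⇒⌈m/2⌉≤n {m} {n} m≤n+n = subst (⌈ m /2⌉ ≤_) (sym (n≡⌈n+n/2⌉ n)) (⌈n/2⌉-mono m≤n+n)

n≤⌈n/2⌉+⌈n/2⌉ : ∀ n → n ≤ ⌈ n /2⌉ + ⌈ n /2⌉
n≤⌈n/2⌉+⌈n/2⌉ n =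
  subst (_≤ ⌈ n /2⌉ + ⌈ n /2⌉) (⌊n/2⌋+⌈n/2⌉≡n n) (+-monoˡ-≤ ⌈ n /2⌉ (⌊n/2⌋≤⌈n/2⌉ n))

n≤2^⌈log₂n⌉ : ∀ n → n ≤ 2 ^ ⌈log₂ n ⌉
n≤2^⌈log₂n⌉ = <-rec (λ n → n ≤ 2 ^ ⌈log₂ n ⌉) bound
  where
  bound : ∀ n → (∀ {m} → m < n → m ≤ 2 ^ ⌈log₂ m ⌉) → n ≤ 2 ^ ⌈log₂ n ⌉
  bound 0 _ = z≤n
  bound 1 _ = ≤-reflexive (cong (2 ^_) (sym (⌈log₂2^n⌉≡n 0)))
  bound n@(suc (suc k)) rec = begin
    n                     ≤⟨ n≤⌈n/2⌉+⌈n/2⌉ n ⟩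
    ⌈ n /2⌉ + ⌈ n /2⌉     ≤⟨ +-mono-≤ half-bound half-bound ⟩
    2 ^ c + 2 ^ c         ≡⟨ cong (2 ^ c +_) (+-identityʳ (2 ^ c)) ⟨
    2 ^ suc c             ≡⟨ cong (2 ^_) log-step ⟩
    2 ^ ⌈log₂ n ⌉         ∎
    where
    open ≤-Reasoning
    c = ⌈log₂ ⌈ n /2⌉ ⌉
    half-bound : ⌈ n /2⌉ ≤ 2 ^ c
    half-bound = rec {⌈ n /2⌉} (⌈n/2⌉<n k)
    1≤log : 1 ≤ ⌈log₂ n ⌉
    1≤log = subst (_≤ ⌈log₂ n ⌉) (⌈log₂2^n⌉≡n 1) (⌈log₂⌉-mono-≤ {2} {n} (s≤s (s≤s z≤n)))
    log-step : suc c ≡ ⌈log₂ n ⌉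
    log-step = trans (cong suc (⌈log₂⌈n/2⌉⌉≡⌈log₂n⌉∸1 n))
                     (trans (+-comm 1 (⌈log₂ n ⌉ ∸ 1)) (m∸n+n≡m 1≤log))

⌈log₂⌉-odd : ∀ {m r} → m ≡ suc (2 * r) → 1 ≤ r → ∃ λ j → ⌈log₂ m ⌉ ≡ suc j × r < 2 ^ j
⌈log₂⌉-odd {m} {r} m≡ 1≤r with ⌈log₂ m ⌉ | n≤2^⌈log₂n⌉ m
... | zero | m≤1 = contradiction (≤-trans (*-monoʳ-≤ 2 1≤r) (≤-pred (subst (_≤ 1) m≡ m≤1))) λ ()
... | suc j | m≤2^suc-j = j , refl , (begin-strict
  r                  <⟨ n<1+n r ⟩
  suc r              ≡⟨ cong suc (trans (n≡⌊n+n/2⌋ r) (cong ⌊_/2⌋ (cong (r +_) (sym (+-identityʳ r))))) ⟩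
  ⌈ suc (2 * r) /2⌉  ≤⟨ m≤n+n⇒⌈m/2⌉≤n m≤2^j+2^j ⟩
  2 ^ j              ∎)
  where
  open ≤-Reasoning
  m≤2^j+2^j : suc (2 * r) ≤ 2 ^ j + 2 ^ j
  m≤2^j+2^j = subst₂ _≤_ m≡ (cong (2 ^ j +_) (+-identityʳ (2 ^ j))) m≤2^suc-j

parity : ∀ m → (∃ λ k → m ≡ 2 * k) ⊎ Odd m
parity zero = inj₁ (0 , refl)
parity (suc m) with parity m
... | inj₁ (k , refl) = inj₂ (k , refl)
... | inj₂ (k , refl) = inj₁ (suc k , double-suc k)
  where
  double-suc : ∀ n → suc (suc (2 * n)) ≡ 2 * suc n
  double-suc = solve-∀

odd? : ∀ m → Dec (Odd m)
odd? m with parity m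
... | inj₂ odd = yes odd
... | inj₁ (k , refl) = no λ { (j , eq) → even≢odd k j eq }

opposite+suc : ∀ {m} (j : Fin m) → toℕ (Fin.opposite j) + suc (toℕ j) ≡ m
opposite+suc j = trans (cong (_+ suc (toℕ j)) (Fin.opposite-prop j)) (m∸n+n≡m (Fin.toℕ<n j))

suc-opposite : ∀ {m} {j j′ : Fin m} → toℕ j′ ≡ suc (toℕ j) →
               suc (toℕ (Fin.opposite j′)) ≡ toℕ (Fin.opposite j)
suc-opposite {m} {j} {j′} j′≡ = +-cancelʳ-≡ (suc (toℕ j)) _ _ (begin
  suc (toℕ (Fin.opposite j′)) + suc (toℕ j)   ≡⟨ +-suc (toℕ (Fin.opposite j′)) (suc (toℕ j)) ⟨
  toℕ (Fin.opposite j′) + suc (suc (toℕ j))   ≡⟨ cong (λ k → toℕ (Fin.opposite j′) + suc k) j′≡ ⟨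
  toℕ (Fin.opposite j′) + suc (toℕ j′)        ≡⟨ opposite+suc j′ ⟩
  m                                          ≡⟨ opposite+suc j ⟨
  toℕ (Fin.opposite j) + suc (toℕ j)         ∎)
  where open ≡-Reasoning

module StallerStrategy (G : Graph) (_≟_ : DecidableEquality (Graph.V G))
    (N : ℕ) (path : ℕ → Graph.V G)
    (path-injective : ∀ {p q} → p < N → q < N → path p ≡ path q → p ≡ q)
    (even-closed : ∀ e {u} → 2 * e < N → InClosedNbhd G (path (2 * e)) u →
      ∃ λ q → q < N × (q ≡ 2 * e ⊎ suc q ≡ 2 * e ⊎ q ≡ suc (2 * e)) × u ≡ path q) where

  open Graph G

  record Segment (S D : List V) (e r : ℕ) : Set where
    field
      fits        : 2 * (e + r) < N
      free        : ∀ {q} → 2 * e ≤ q → q ≤ 2 * (e + r) → Free G (path q) S D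
      left-flank  : ∀ {q} → suc q ≡ 2 * e → path q ∈ S
      right-flank : ∀ {q} → suc (2 * (e + r)) ≡ q → q < N → path q ∈ S

  claimSingleton : ∀ {S D e k} → Segment S D e 0 → StallerWinsWithin G (suc k) S D
  claimSingleton {S} {D} {e} seg =
    path (2 * e) , free ≤-refl end-eq , inj₁ (path (2 * e) , surrounded)
    where
    open Segment seg
    end-eq : 2 * e ≤ 2 * (e + 0)
    end-eq = ≤-reflexive (cong (2 *_) (sym (+-identityʳ e)))
    surrounded : ∀ u → InClosedNbhd G (path (2 * e)) u → u ∈ path (2 * e) ∷ S
    surrounded u u∈N with even-closed e (≤-<-trans end-eq fits) u∈N
    ... | q , _   , inj₁ refl , refl = here refl
    ... | q , _   , inj₂ (inj₁ q+1≡) , refl = there (left-flank q+1≡)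
    ... | q , q<N , inj₂ (inj₂ q≡) , refl =
      there (right-flank (trans (cong (suc ∘ (2 *_)) (+-identityʳ e)) (sym q≡)) q<N)

  private
    split-end : ∀ e r₁ r₂ → 2 * (suc (e + r₁) + r₂) ≡ 2 * (e + suc (r₁ + r₂))
    split-end = solve-∀

    split-start : ∀ e r₁ → 2 * suc (e + r₁) ≡ suc (suc (2 * (e + r₁)))
    split-start = solve-∀

  -- Staller claims the middle odd position; the half that Dominator leaves alone is again a segment.
  module Halving {S D e r} (seg : Segment S D e (suc r)) where
    open Segment seg

    r₁ r₂ middle end : ℕ
    r₁ = ⌊ r /2⌋
    r₂ = ⌈ r /2⌉
    middle = suc (2 * (e + r₁))
    end = 2 * (e + suc r)

    private
      end≡ : 2 * (suc (e + r₁) + r₂) ≡ end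
      end≡ = trans (split-end e r₁ r₂) (cong (λ k → 2 * (e + suc k)) (⌊n/2⌋+⌈n/2⌉≡n r))
      start<middle : 2 * e < middle
      start<middle = s≤s (*-monoʳ-≤ 2 (m≤m+n e r₁))
      middle<right-start : middle < 2 * suc (e + r₁)
      middle<right-start = ≤-reflexive (sym (split-start e r₁))
      right-start≤end : 2 * suc (e + r₁) ≤ end
      right-start≤end = subst (2 * suc (e + r₁) ≤_) end≡ (*-monoʳ-≤ 2 (m≤m+n (suc (e + r₁)) r₂))
      middle≤end : middle ≤ end
      middle≤end = ≤-trans (n≤1+n middle) (≤-trans middle<right-start right-start≤end)
      left-end≤end : 2 * (e + r₁) ≤ end
      left-end≤end = ≤-trans (n≤1+n _) middle≤end
      in-path : ∀ {q} → q ≤ end → q < N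
      in-path q≤end = ≤-<-trans q≤end fits
      path-middle≢ : ∀ {q} → q ≢ middle → q ≤ end → path q ≢ path middle
      path-middle≢ q≢m q≤end eq = q≢m (path-injective (in-path q≤end) (in-path middle≤end) eq)

    middle-free : Free G (path middle) S D
    middle-free = free (<⇒≤ start<middle) middle≤end

    start-free : Free G (path (2 * e)) (path middle ∷ S) D
    start-free with free ≤-refl (≤-trans (<⇒≤ start<middle) middle≤end)
    ... | ∉S , ∉D =
      (λ { (here eq) → path-middle≢ (<⇒≢ start<middle) (≤-trans (<⇒≤ start<middle) middle≤end) eq
         ; (there p) → ∉S p }) , ∉D

    OnLeftHalf : V → Set
    OnLeftHalf u = ∃ λ q → 2 * e ≤ q × q ≤ 2 * (e + r₁) × u ≡ path q

    onLeftHalf? : ∀ u → Dec (OnLeftHalf u)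
    onLeftHalf? u with Fin.any? {n = suc (2 * (e + r₁))} (λ i → 2 * e ≤? toℕ i ×-dec u ≟ path (toℕ i))
    ... | yes (i , 2e≤i , u≡) = yes (toℕ i , 2e≤i , ≤-pred (Fin.toℕ<n i) , u≡)
    ... | no ¬∃ = no λ { (q , 2e≤q , q≤ , u≡) → ¬∃ (fromℕ< (s≤s q≤) ,
            subst (λ k → 2 * e ≤ k × u ≡ path k) (sym (Fin.toℕ-fromℕ< (s≤s q≤))) (2e≤q , u≡)) }

    leftHalf : ∀ {u} → ¬ OnLeftHalf u → Segment (path middle ∷ S) (u ∷ D) e r₁
    leftHalf {u} ¬left = record
      { fits = ≤-<-trans left-end≤end fits
      ; free = free′
      ; left-flank = there ∘ left-flank
      ; right-flank = λ middle≡q _ → here (cong path (sym middle≡q))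
      }
      where
      free′ : ∀ {q} → 2 * e ≤ q → q ≤ 2 * (e + r₁) → Free G (path q) (path middle ∷ S) (u ∷ D)
      free′ {q} 2e≤q q≤ with free 2e≤q (≤-trans q≤ left-end≤end)
      ... | ∉S , ∉D =
        (λ { (here eq) → path-middle≢ (<⇒≢ (s≤s q≤)) (≤-trans q≤ left-end≤end) eq
           ; (there p) → ∉S p }) ,
        (λ { (here eq) → ¬left (q , 2e≤q , q≤ , sym eq) ; (there p) → ∉D p })

    rightHalf : ∀ {u} → OnLeftHalf u → Segment (path middle ∷ S) (u ∷ D) (suc (e + r₁)) r₂
    rightHalf {u} (q₀ , _ , q₀≤ , u≡) = record
      { fits = subst (_< N) (sym end≡) fits
      ; free = free′
      ; left-flank = λ q+1≡ → here (cong path (suc-injective (trans q+1≡ (split-start e r₁))))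
      ; right-flank = λ end+1≡q → there ∘ right-flank (trans (cong suc (sym end≡)) end+1≡q)
      }
      where
      free′ : ∀ {q} → 2 * suc (e + r₁) ≤ q → q ≤ 2 * (suc (e + r₁) + r₂) →
              Free G (path q) (path middle ∷ S) (u ∷ D)
      free′ {q} start≤q q≤ with free (≤-trans (<⇒≤ start<middle) (<⇒≤ middle<q)) q≤end
        where
        middle<q = <-≤-trans middle<right-start start≤q
        q≤end = subst (q ≤_) end≡ q≤
      ... | ∉S , ∉D =
        (λ { (here eq) → path-middle≢ (>⇒≢ middle<q) q≤end eq ; (there p) → ∉S p }) ,
        (λ { (here eq) → <⇒≢ (<-trans (s≤s q₀≤) middle<q)
                            (path-injective (in-path (≤-trans q₀≤ left-end≤end)) (in-path q≤end)
                                            (trans (sym u≡) (sym eq)))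
           ; (there p) → ∉D p })
        where
        middle<q = <-≤-trans middle<right-start start≤q
        q≤end = subst (q ≤_) end≡ q≤

  segmentWin : ∀ j {S D e r} → Segment S D e r → r < 2 ^ j → StallerWinsWithin G (suc j) S D
  segmentWin j {r = zero} seg _ = claimSingleton seg
  segmentWin zero {r = suc r} seg (s≤s ())
  segmentWin (suc j) {S} {D} {e} {suc r} seg r<2^j =
    path middle , middle-free , inj₂ ((path (2 * e) , start-free) , continue)
    where
    open Halving seg
    r₂<2^j : r₂ < 2 ^ j
    r₂<2^j = m≤n+n⇒⌈m/2⌉≤n (subst (suc (suc r) ≤_) (cong (2 ^ j +_) (+-identityʳ (2 ^ j))) r<2^j)
    continue : ∀ u → Free G u (path middle ∷ S) D → StallerWinsWithin G (suc j) (path middle ∷ S) (u ∷ D)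
    continue u _ with onLeftHalf? u
    ... | yes left = segmentWin j (rightHalf left) r₂<2^j
    ... | no ¬left = segmentWin j (leftHalf ¬left) (≤-<-trans (⌊n/2⌋≤⌈n/2⌉ r) r₂<2^j)

  stallerWins : ∀ {r j} → N ≡ suc (2 * r) → r < 2 ^ j → StallerWinsWithin G (suc j) [] []
  stallerWins {r} N≡ = segmentWin _ whole
    where
    whole : Segment [] [] 0 r
    whole = record
      { fits = ≤-reflexive (sym N≡)
      ; free = λ _ _ → (λ ()) , (λ ())
      ; left-flank = λ ()
      ; right-flank = λ end+1≡q q<N → contradiction (trans N≡ end+1≡q) (>⇒≢ q<N)
      }

module DominatorStrategy (G : Graph) (_≟_ : DecidableEquality (Graph.V G))
    (adj-sym : ∀ {a b} → Graph.Adj G a b → Graph.Adj G b a) (adj-irrefl : ∀ {a} → ¬ Graph.Adj G a a) where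

  open Graph G

  open Bags _≟_
  open import Data.List.Membership.DecPropositional _≟_ using (_∈?_)

  data Structure : Set where
    pair   : V → V → Structure
    spider : V → List (List V) → Structure

  vertices : Structure → List V
  vertices (pair a b)      = a ∷ b ∷ []
  vertices (spider c legs) = c ∷ concat legs

  verticesOf : List Structure → List V
  verticesOf = concatMap vertices

  WellFormed : Structure → Set
  WellFormed (pair a b)      = Adj a b
  WellFormed (spider c legs) = 2 ≤ length legs × All (λ leg → Linked Adj (c ∷ leg)) legs

  LegsBound : ℕ → List V → List V → Set
  LegsBound B A C = B ≤ 2 + length A + length C

  Bounded : ℕ → Structure → Set
  Bounded B (pair _ _)      = ⊤
  Bounded B (spider _ legs) = AllPairs (LegsBound B) legs

  Dominated : List V → V → Set
  Dominated D w = ∃ λ y → y ∈ D × InClosedNbhd G w y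

  record Invariant (τ : List Structure) (S D : List V) : Set where
    field
      disjoint   : ∀ {x} → x ∈ S → x ∉ D
      unclaimed  : ∀ {x} → x ∈ verticesOf τ → Free G x S D
      distinct   : Distinct (verticesOf τ)
      wellFormed : All WellFormed τ
      covers     : ∀ w → Dominated D w ⊎ w ∈ verticesOf τ

  ∈-verticesOf⁻ : ∀ {w} τ → w ∈ verticesOf τ → ∃ λ s → s ∈ τ × w ∈ vertices s
  ∈-verticesOf⁻ (s ∷ τ) w∈ with ∈-++⁻ (vertices s) w∈
  ... | inj₁ w∈s = s , here refl , w∈s
  ... | inj₂ w∈τ with ∈-verticesOf⁻ τ w∈τ
  ...   | s′ , s′∈ , w∈s′ = s′ , there s′∈ , w∈s′

  ∈-verticesOf⁺ : ∀ {w s τ} → s ∈ τ → w ∈ vertices s → w ∈ verticesOf τ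
  ∈-verticesOf⁺ (here refl) w∈s = ∈-++⁺ˡ w∈s
  ∈-verticesOf⁺ {τ = s′ ∷ _} (there s∈) w∈s = ∈-++⁺ʳ (vertices s′) (∈-verticesOf⁺ s∈ w∈s)

  verticesOf-↭ : ∀ {τ τ′} → τ ↭ τ′ → verticesOf τ ↭ verticesOf τ′
  verticesOf-↭ p = concat-↭ (Perm.map⁺ vertices p)

  self-dominated : ∀ {u D} → Dominated (u ∷ D) u
  self-dominated {u} = u , here refl , inj₁ refl

  adj-dominated : ∀ {w u D} → Adj w u → Dominated (u ∷ D) w
  adj-dominated {u = u} w~u = u , here refl , inj₂ w~u

  weaken-dominated : ∀ {w u D} → Dominated D w → Dominated (u ∷ D) w
  weaken-dominated (y , y∈D , y∈N) = y , there y∈D , y∈N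

  halve-bounded : ∀ {B s} → Bounded B s → Bounded ⌈ B /2⌉ s
  halve-bounded {B} {pair _ _} _ = tt
  halve-bounded {B} {spider _ _} b = AllPairs.map (≤-trans (⌈n/2⌉≤n B)) b


  -- 3 ≤ B excludes the one structure with an isolated vertex: a spider all of whose legs are empty.
  structureNeighbour : ∀ {s B w} → WellFormed s → Bounded B s → 3 ≤ B → w ∈ vertices s →
                       ∃ λ z → z ∈ vertices s × Adj w z
  structureNeighbour {pair a b} a~b _ _ (here refl) = b , there (here refl) , a~b
  structureNeighbour {pair a b} a~b _ _ (there (here refl)) = a , here refl , adj-sym a~b
  structureNeighbour {spider c (A ∷ C ∷ legs)} (_ , lA ∷ lC ∷ _) ((A-C ∷ _) ∷ _) 3≤B (here refl)
    with A | C | lA | lC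
  ... | h ∷ _ | _ | c~h ∷ _ | _ = h , there (here refl) , c~h
  ... | [] | h ∷ _ | _ | c~h ∷ _ = h , there (here refl) , c~h
  ... | [] | [] | _ | _ = contradiction (≤-trans 3≤B A-C) λ { (s≤s (s≤s ())) }
  structureNeighbour {spider c (_ ∷ [])} (s≤s () , _) _ _ (here refl)
  structureNeighbour {spider c legs} (_ , linked) _ _ (there w∈) with ∈-concat⁻′ legs w∈
  ... | A , w∈A , A∈ with linked-predecessor (All.lookup linked A∈) w∈A
  ...   | p , p∈ , p~w = p , pred∈ p∈ , adj-sym p~w
    where
    pred∈ : ∀ {p} → p ∈ c ∷ A → p ∈ c ∷ concat legs
    pred∈ (here refl) = here refl
    pred∈ (there p∈A) = there (∈-concat⁺′ p∈A A∈)

  stallerCannotWinAtOnce : ∀ {τ S D B v} → Invariant τ S D → All (Bounded B) τ → 3 ≤ B → v ∉ D →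
                           ¬ StallerWon G (v ∷ S)
  stallerCannotWinAtOnce {τ} {S} {D} {v = v} I bounded 3≤B v∉D (w , N[w]⊆) with Invariant.covers I w
  ... | inj₁ (y , y∈D , y∈N) with N[w]⊆ y y∈N
  ...   | here refl = v∉D y∈D
  ...   | there y∈S = Invariant.disjoint I y∈S y∈D
  stallerCannotWinAtOnce {τ} {S} {D} {v = v} I bounded 3≤B v∉D (w , N[w]⊆) | inj₂ w∈τ
    with ∈-verticesOf⁻ τ w∈τ
  ... | s , s∈ , w∈s
    with structureNeighbour (All.lookup (Invariant.wellFormed I) s∈) (All.lookup bounded s∈) 3≤B w∈s
  ...   | z , z∈s , w~z
    with onlyStaller w (inj₁ refl) w∈τ | onlyStaller z (inj₂ w~z) (∈-verticesOf⁺ s∈ z∈s)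
    where
    onlyStaller : ∀ x → InClosedNbhd G w x → x ∈ verticesOf τ → x ≡ v
    onlyStaller x x∈N x∈τ with N[w]⊆ x x∈N
    ... | here x≡v = x≡v
    ... | there x∈S = contradiction x∈S (proj₁ (Invariant.unclaimed I x∈τ))
  ... | refl | refl = adj-irrefl w~z


  Invariant-resp-↭ : ∀ {τ τ′ S D} → verticesOf τ ↭ verticesOf τ′ → All WellFormed τ′ →
                     Invariant τ S D → Invariant τ′ S D
  Invariant-resp-↭ p wf I = record
    { disjoint = disjoint
    ; unclaimed = unclaimed ∘ Perm.∈-resp-↭ (↭-sym p)
    ; distinct = λ x → subst (_≤ 1) (count-resp-↭ p) (distinct x)
    ; wellFormed = wf
    ; covers = map₂ (Perm.∈-resp-↭ p) ∘ covers
    }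
    where open Invariant I

  rotateStructures : ∀ {τ τ′ S D} → τ ↭ τ′ → Invariant τ S D → Invariant τ′ S D
  rotateStructures p I = Invariant-resp-↭ (verticesOf-↭ p) (Perm.All-resp-↭ p (Invariant.wellFormed I)) I

  rotateLegs : ∀ {c legs legs′ ρ S D} → legs ↭ legs′ →
               Invariant (spider c legs ∷ ρ) S D → Invariant (spider c legs′ ∷ ρ) S D
  rotateLegs {ρ = ρ} p I with Invariant.wellFormed I
  ... | (2≤ , linked) ∷ wfρ =
    Invariant-resp-↭ (Perm.++⁺ʳ (verticesOf ρ) (prep _ (concat-↭ p)))
      ((subst (2 ≤_) (Perm.↭-length p) 2≤ , Perm.All-resp-↭ p linked) ∷ wfρ) I

  rotateLegs-bounded : ∀ {B legs legs′} → legs ↭ legs′ →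
                       AllPairs (LegsBound B) legs → AllPairs (LegsBound B) legs′
  rotateLegs-bounded {B} = AllPairs-resp-↭ (λ {A} {C} → sym-bound {A} {C})
    where
    sym-bound : ∀ {A C} → LegsBound B A C → LegsBound B C A
    sym-bound {A} {C} = subst (λ k → B ≤ 2 + k) (+-comm (length A) (length C))


  record Response (s : Structure) (claimed : List V) (u : V) (D : List V) (B : ℕ) : Set where
    field
      pieces     : List Structure
      sub-bag    : claimed ++ verticesOf pieces ⊑ vertices s
      wellFormed : All WellFormed pieces
      bounded    : All (Bounded B) pieces
      covers     : ∀ {w} → w ∈ vertices s → Dominated (u ∷ D) w ⊎ w ∈ verticesOf pieces

  DominatorAnswers : List V → List V → ℕ → V → Set
  DominatorAnswers S D B v =
    ∃ λ u → Free G u (v ∷ S) D × ∃ λ τ → Invariant τ (v ∷ S) (u ∷ D) × All (Bounded ⌈ B /2⌉) τ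

  -- claimed holds Dominator's u and, when it lies in s, Staller's v.
  private
    module Replacement {s ρ S D B v u claimed} (I : Invariant (s ∷ ρ) S D) (R : Response s claimed u D B)
        (v-free : Free G v S D) (u∈ : u ∈ claimed) (u≢v : u ≢ v)
        (v-claimed : v ∈ claimed ⊎ v ∉ verticesOf (s ∷ ρ))
        where
      open Response R
      open Invariant I using (unclaimed; disjoint)

      τ′ : List Structure
      τ′ = pieces ++ ρ

      ∈-τ′ : ∀ {w} → w ∈ verticesOf pieces ⊎ w ∈ verticesOf ρ → w ∈ verticesOf τ′
      ∈-τ′ w∈ = subst (_ ∈_) (sym (List.concatMap-++ vertices pieces ρ))
                  ([ ∈-++⁺ˡ , ∈-++⁺ʳ (verticesOf pieces) ]′ w∈)

      claimed-and-rest : claimed ++ verticesOf τ′ ⊑ verticesOf (s ∷ ρ)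
      claimed-and-rest = begin
        claimed ++ verticesOf τ′
          ≡⟨ cong (claimed ++_) (List.concatMap-++ vertices pieces ρ) ⟩
        claimed ++ verticesOf pieces ++ verticesOf ρ
          ≡⟨ List.++-assoc claimed _ _ ⟨
        (claimed ++ verticesOf pieces) ++ verticesOf ρ
          ≲⟨ ⊑-++⁺ʳ (verticesOf ρ) sub-bag ⟩
        vertices s ++ verticesOf ρ
          ∎
        where open ⊑-Reasoning

      shrinks : verticesOf τ′ ⊑ verticesOf (s ∷ ρ)
      shrinks = ⊑-trans (ys⊑xs++ys claimed) claimed-and-rest

      claimed-gone : ∀ {x} → x ∈ claimed → x ∉ verticesOf τ′
      claimed-gone = Distinct-++ claimed (Distinct-⊑ claimed-and-rest (Invariant.distinct I))

      v-gone : v ∉ verticesOf τ′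
      v-gone = [ claimed-gone , (λ v∉ → v∉ ∘ ∈-resp-⊑ shrinks) ]′ v-claimed

      u-free : Free G u (v ∷ S) D
      u-free with unclaimed (∈-resp-⊑ claimed-and-rest (∈-++⁺ˡ u∈))
      ... | u∉S , u∉D = (λ { (here u≡v) → u≢v u≡v ; (there u∈S) → u∉S u∈S }) , u∉D

      covers′ : ∀ w → Dominated (u ∷ D) w ⊎ w ∈ verticesOf τ′
      covers′ w with Invariant.covers I w
      ... | inj₁ dominated = inj₁ (weaken-dominated dominated)
      ... | inj₂ w∈ with ∈-++⁻ (vertices s) w∈
      ...   | inj₂ w∈ρ = inj₂ (∈-τ′ (inj₂ w∈ρ))
      ...   | inj₁ w∈s = map₂ (∈-τ′ ∘ inj₁) (covers w∈s)

      invariant : Invariant τ′ (v ∷ S) (u ∷ D)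
      invariant = record
        { disjoint = λ
            { (here refl) (here u≡v) → u≢v (sym u≡v)
            ; (here refl) (there v∈D) → proj₂ v-free v∈D
            ; (there x∈S) (here refl) → proj₁ u-free (there x∈S)
            ; (there x∈S) (there x∈D) → disjoint x∈S x∈D }
        ; unclaimed = λ {x} x∈ →
            (λ { (here refl) → v-gone x∈
               ; (there x∈S) → proj₁ (unclaimed (∈-resp-⊑ shrinks x∈)) x∈S }) ,
            (λ { (here refl) → claimed-gone u∈ x∈
               ; (there x∈D) → proj₂ (unclaimed (∈-resp-⊑ shrinks x∈)) x∈D })
        ; distinct = Distinct-⊑ shrinks (Invariant.distinct I)
        ; wellFormed = All.++⁺ wellFormed (All.tail (Invariant.wellFormed I))
        ; covers = covers′
        }

    replaceFront : ∀ {s ρ S D B v u claimed} → Invariant (s ∷ ρ) S D → All (Bounded B) (s ∷ ρ) →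
      Free G v S D → Response s claimed u D ⌈ B /2⌉ → u ∈ claimed → u ≢ v →
      v ∈ claimed ⊎ v ∉ verticesOf (s ∷ ρ) → DominatorAnswers S D B v
    replaceFront {ρ = ρ} {u = u} I (_ ∷ bounded-ρ) v-free R u∈ u≢v v-claimed =
      u , u-free , τ′ , invariant , All.++⁺ (Response.bounded R) (All.map halve-bounded bounded-ρ)
      where open Replacement I R v-free u∈ u≢v v-claimed

  respondInside : ∀ {s ρ S D B v u} → Invariant (s ∷ ρ) S D → All (Bounded B) (s ∷ ρ) →
    Free G v S D → Response s (v ∷ u ∷ []) u D ⌈ B /2⌉ → DominatorAnswers S D B v
  respondInside {s} {ρ} {v = v} {u} I bounded v-free R =
    replaceFront I bounded v-free R (there (here refl)) u≢v (inj₁ (here refl))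
    where
    u≢v : u ≢ v
    u≢v refl = Distinct-++ (v ∷ []) {v ∷ []} v∷v-distinct (here refl) (here refl)
      where
      v∷v-distinct : Distinct (v ∷ v ∷ [])
      v∷v-distinct = Distinct-⊑ (⊑-trans (xs⊑xs++ys (v ∷ v ∷ [])) (Response.sub-bag R))
                       (Distinct-⊑ (xs⊑xs++ys (vertices s) {verticesOf ρ}) (Invariant.distinct I))

  respondOutside : ∀ {s ρ S D B v u} → Invariant (s ∷ ρ) S D → All (Bounded B) (s ∷ ρ) →
    Free G v S D → v ∉ verticesOf (s ∷ ρ) → Response s [ u ] u D ⌈ B /2⌉ → DominatorAnswers S D B v
  respondOutside {s} {ρ} {v = v} {u} I bounded v-free v∉ R =
    replaceFront I bounded v-free R (here refl) u≢v (inj₂ v∉)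
    where
    u≢v : u ≢ v
    u≢v refl = v∉ (∈-++⁺ˡ (∈-resp-⊑ (Response.sub-bag R) (here refl)))


  pairUp : List V → List Structure
  pairUp (a ∷ b ∷ xs) = pair a b ∷ pairUp xs
  pairUp _            = []

  pairUp-⊑ : ∀ xs → verticesOf (pairUp xs) ⊑ xs
  pairUp-⊑ (a ∷ b ∷ xs) = ⊑-++⁺ˡ (a ∷ b ∷ []) (pairUp-⊑ xs)
  pairUp-⊑ []           = []⊑
  pairUp-⊑ (_ ∷ [])     = []⊑

  pairUp-wellFormed : ∀ {xs} → Linked Adj xs → All WellFormed (pairUp xs)
  pairUp-wellFormed (a~b ∷ [-])     = a~b ∷ []
  pairUp-wellFormed (a~b ∷ _ ∷ l)   = a~b ∷ pairUp-wellFormed l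
  pairUp-wellFormed []              = []
  pairUp-wellFormed [-]             = []

  pairUp-bounded : ∀ {B} xs → All (Bounded B) (pairUp xs)
  pairUp-bounded (a ∷ b ∷ xs) = tt ∷ pairUp-bounded xs
  pairUp-bounded []           = []
  pairUp-bounded (_ ∷ [])     = []

  pairUp-covers : ∀ {d w} xs → Linked Adj (xs ++ [ d ]) → w ∈ xs → w ∈ verticesOf (pairUp xs) ⊎ Adj w d
  pairUp-covers (x ∷ []) (x~d ∷ _) (here refl) = inj₂ x~d
  pairUp-covers (a ∷ b ∷ xs) _ (here refl) = inj₁ (here refl)
  pairUp-covers (a ∷ b ∷ xs) _ (there (here refl)) = inj₁ (there (here refl))
  pairUp-covers (a ∷ b ∷ xs) l (there (there w∈)) =
    map₁ (there ∘ there) (pairUp-covers xs (Linked.tail (Linked.tail l)) w∈)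

  pairUp-covers-even : ∀ {w} xs k → length xs ≡ 2 * k → w ∈ xs → w ∈ verticesOf (pairUp xs)
  pairUp-covers-even (x ∷ []) k 1≡2k _ = contradiction (sym 1≡2k) (even≢odd k 0)
  pairUp-covers-even (a ∷ b ∷ xs) k _ (here refl) = here refl
  pairUp-covers-even (a ∷ b ∷ xs) k _ (there (here refl)) = there (here refl)
  pairUp-covers-even (a ∷ b ∷ xs) (suc k) len≡ (there (there w∈)) =
    there (there (pairUp-covers-even xs k (suc-injective (suc-injective (trans len≡ (double-suc k)))) w∈))
    where
    double-suc : ∀ k → 2 * suc k ≡ suc (suc (2 * k))
    double-suc = solve-∀

  ∈-verticesOf-concatMap : ∀ {w A As} (f : List V → List Structure) → A ∈ As → w ∈ verticesOf (f A) →
                           w ∈ verticesOf (concatMap f As)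
  ∈-verticesOf-concatMap {A = A} f A∈ w∈ with ∈-verticesOf⁻ (f A) w∈
  ... | s , s∈ , w∈s = ∈-verticesOf⁺ (∈-concat⁺′ s∈ (∈-map⁺ f A∈)) w∈s

  concatMap-pairUp-⊑ : ∀ (f : List V → List V) → (∀ A → f A ↭ A) → ∀ As →
                       verticesOf (concatMap (pairUp ∘ f) As) ⊑ concat As
  concatMap-pairUp-⊑ f fA↭A [] = []⊑
  concatMap-pairUp-⊑ f fA↭A (A ∷ As) = begin
    verticesOf (pairUp (f A) ++ concatMap (pairUp ∘ f) As)
      ≡⟨ List.concatMap-++ vertices (pairUp (f A)) _ ⟩
    verticesOf (pairUp (f A)) ++ verticesOf (concatMap (pairUp ∘ f) As)
      ≲⟨ ⊑-++⁺ (pairUp-⊑ (f A)) (concatMap-pairUp-⊑ f fA↭A As) ⟩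
    f A ++ concat As
      ≈⟨ Perm.++⁺ʳ (concat As) (fA↭A A) ⟩
    A ++ concat As ∎
    where open ⊑-Reasoning

  piece : List V → List Structure
  piece []      = []
  piece (h ∷ t) = [ spider h ([] ∷ t ∷ []) ]

  verticesOf-piece : ∀ xs → verticesOf (piece xs) ≡ xs
  verticesOf-piece []      = refl
  verticesOf-piece (h ∷ t) = trans (List.++-identityʳ _) (cong (h ∷_) (List.++-identityʳ t))

  piece-wellFormed : ∀ {x xs} → Linked Adj (x ∷ xs) → All WellFormed (piece xs)
  piece-wellFormed {xs = []} _ = []
  piece-wellFormed {xs = h ∷ t} l = (s≤s (s≤s z≤n) , [-] ∷ Linked.tail l ∷ []) ∷ []

  piece-bounded : ∀ {B} xs → (1 ≤ length xs → B ≤ suc (length xs) + suc (length xs)) →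
                  All (Bounded ⌈ B /2⌉) (piece xs)
  piece-bounded []      _ = []
  piece-bounded (h ∷ t) B≤ = ((m≤n+n⇒⌈m/2⌉≤n (B≤ (s≤s z≤n)) ∷ []) ∷ [] ∷ []) ∷ []


  claimFirst : ∀ {a b D B} → Adj a b → Response (pair a b) [ a ] a D B
  claimFirst a~b = record
    { pieces = [] ; sub-bag = xs⊑xs++ys [ _ ] ; wellFormed = [] ; bounded = []
    ; covers = λ { (here refl) → inj₁ self-dominated
                 ; (there (here refl)) → inj₁ (adj-dominated (adj-sym a~b)) } }

  claimPartner : ∀ {a b D B} → Adj a b → Response (pair a b) (a ∷ b ∷ []) b D B
  claimPartner a~b = record
    { pieces = [] ; sub-bag = ↭⇒⊑ (↭-reflexive (List.++-identityʳ _)) ; wellFormed = [] ; bounded = []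
    ; covers = λ { (here refl) → inj₁ (adj-dominated a~b) ; (there (here refl)) → inj₁ self-dominated } }

  -- Each leg is paired up from its far end, so only its vertex next to the centre can stay unpaired.
  claimCentre : ∀ {c legs D B} → WellFormed (spider c legs) → Response (spider c legs) [ c ] c D B
  claimCentre {c} {legs} {D} (_ , linked) = record
    { pieces = concatMap (pairUp ∘ reverse) legs
    ; sub-bag = ⊑-++⁺ˡ [ c ] (concatMap-pairUp-⊑ reverse Perm.↭-reverse legs)
    ; wellFormed = All.concat⁺ (All.map⁺ {xs = legs} (All.tabulate λ {A} A∈ →
        pairUp-wellFormed (linked-++⁻ˡ (reverse A) (reversed-linked (All.lookup linked A∈)))))
    ; bounded = All.concat⁺ (All.map⁺ {xs = legs} (All.tabulate λ {A} _ → pairUp-bounded (reverse A)))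
    ; covers = covers
    }
    where
    reversed-linked : ∀ {A} → Linked Adj (c ∷ A) → Linked Adj (reverse A ++ [ c ])
    reversed-linked {A} l = subst (Linked Adj) (List.ʳ++-defn A) (ʳ++-linked A (Linked.map adj-sym l) [-])
    covers : ∀ {w} → w ∈ c ∷ concat legs →
             Dominated (c ∷ D) w ⊎ w ∈ verticesOf (concatMap (pairUp ∘ reverse) legs)
    covers (here refl) = inj₁ self-dominated
    covers (there w∈) with ∈-concat⁻′ legs w∈
    ... | A , w∈A , A∈
      with pairUp-covers (reverse A) (reversed-linked (All.lookup linked A∈)) (Any.reverse⁺ w∈A)
    ...   | inj₁ paired = inj₂ (∈-verticesOf-concatMap (pairUp ∘ reverse) A∈ paired)
    ...   | inj₂ w~c = inj₁ (adj-dominated w~c)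

  leg-split-↭ : ∀ (c : V) pre v post others →
    c ∷ (pre ++ v ∷ post) ++ others ↭ v ∷ (c ∷ pre ++ others) ++ post
  leg-split-↭ c pre v post others = begin
    c ∷ (pre ++ v ∷ post) ++ others   ≡⟨ cong (c ∷_) (List.++-assoc pre (v ∷ post) others) ⟩
    c ∷ pre ++ v ∷ post ++ others     ↭⟨ prep c (Perm.shift v pre (post ++ others)) ⟩
    c ∷ v ∷ pre ++ post ++ others     ↭⟨ swap c v ↭-refl ⟩
    v ∷ c ∷ pre ++ post ++ others     ↭⟨ prep v (prep c (Perm.++⁺ˡ pre (Perm.++-comm post others))) ⟩
    v ∷ c ∷ pre ++ others ++ post     ≡⟨ cong (λ xs → v ∷ c ∷ xs) (List.++-assoc pre others post) ⟨
    v ∷ (c ∷ pre ++ others) ++ post   ∎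
    where open PermutationReasoning

  -- The rest of p's leg is paired up towards p; if only one other leg remains, the spider degenerates
  -- into a path through the centre, which is paired up towards p as well.
  claimLegEnd : ∀ {c pre p others D B} → WellFormed (spider c ((pre ++ [ p ]) ∷ others)) →
    AllPairs (LegsBound B) others → Response (spider c ((pre ++ [ p ]) ∷ others)) [ p ] p D B
  claimLegEnd {others = []} (s≤s () , _) _
  claimLegEnd {c} {pre} {p} {C ∷ []} {D} (_ , lA ∷ lC ∷ []) _ = record
    { pieces = pairUp path
    ; sub-bag = ⊑-trans (⊑-++⁺ˡ [ p ] (pairUp-⊑ path)) (↭⇒⊑ (↭-sym rearranged))
    ; wellFormed = pairUp-wellFormed (linked-++⁻ˡ path path-linked)
    ; bounded = pairUp-bounded path
    ; covers = λ w∈ → covers (Perm.∈-resp-↭ rearranged w∈)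
    }
    where
    path = reverse C ++ c ∷ pre
    path-linked : Linked Adj (path ++ [ p ])
    path-linked = subst (Linked Adj) (trans (List.ʳ++-defn C) (sym (List.++-assoc (reverse C) (c ∷ pre) [ p ])))
                    (ʳ++-linked C (Linked.map adj-sym lC) lA)
    rearranged : c ∷ (pre ++ [ p ]) ++ C ++ [] ↭ p ∷ path
    rearranged = begin
      c ∷ (pre ++ [ p ]) ++ C ++ []   ↭⟨ leg-split-↭ c pre p [] (C ++ []) ⟩
      p ∷ (c ∷ pre ++ C ++ []) ++ []  ≡⟨ cong (p ∷_) (trans (List.++-identityʳ _)
                                           (cong (λ xs → c ∷ pre ++ xs) (List.++-identityʳ C))) ⟩
      p ∷ (c ∷ pre) ++ C              ↭⟨ prep p (Perm.++-comm (c ∷ pre) C) ⟩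
      p ∷ C ++ c ∷ pre                ↭⟨ prep p (Perm.++⁺ʳ (c ∷ pre) (↭-sym (Perm.↭-reverse C))) ⟩
      p ∷ path                        ∎
      where open PermutationReasoning
    covers : ∀ {w} → w ∈ p ∷ path → Dominated (p ∷ D) w ⊎ w ∈ verticesOf (pairUp path)
    covers (here refl) = inj₁ self-dominated
    covers (there w∈) with pairUp-covers path path-linked w∈
    ... | inj₁ paired = inj₂ paired
    ... | inj₂ w~p = inj₁ (adj-dominated w~p)
  claimLegEnd {c} {pre} {p} {others@(_ ∷ _ ∷ _)} {D} (_ , lA ∷ lOthers) bounded = record
    { pieces = spider c others ∷ pairUp pre
    ; sub-bag = begin
        p ∷ (c ∷ concat others) ++ verticesOf (pairUp pre)  ≲⟨ ⊑-++⁺ˡ (p ∷ c ∷ concat others) (pairUp-⊑ pre) ⟩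
        p ∷ (c ∷ concat others) ++ pre                       ≈⟨ ↭-sym rearranged ⟩
        c ∷ (pre ++ [ p ]) ++ concat others                  ∎
    ; wellFormed = (s≤s (s≤s z≤n) , lOthers) ∷ pairUp-wellFormed (linked-++⁻ˡ pre (Linked.tail lA))
    ; bounded = bounded ∷ pairUp-bounded pre
    ; covers = λ w∈ → covers (Perm.∈-resp-↭ rearranged w∈)
    }
    where
    open ⊑-Reasoning
    rearranged : c ∷ (pre ++ [ p ]) ++ concat others ↭ p ∷ (c ∷ concat others) ++ pre
    rearranged = ↭-trans (leg-split-↭ c pre p [] (concat others))
      (↭-trans (↭-reflexive (List.++-identityʳ _)) (prep p (prep c (Perm.++-comm pre (concat others)))))
    covers : ∀ {w} → w ∈ p ∷ (c ∷ concat others) ++ pre →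
             Dominated (p ∷ D) w ⊎ w ∈ (c ∷ concat others) ++ verticesOf (pairUp pre)
    covers (here refl) = inj₁ self-dominated
    covers (there w∈) with ∈-++⁻ (c ∷ concat others) w∈
    ... | inj₁ w∈spider = inj₂ (∈-++⁺ˡ w∈spider)
    ... | inj₂ w∈pre with pairUp-covers pre (Linked.tail lA) w∈pre
    ...   | inj₁ paired = inj₂ (∈-++⁺ʳ (c ∷ concat others) paired)
    ...   | inj₂ w~p = inj₁ (adj-dominated w~p)

  -- Staller's vertex v splits s into a part X, where Dominator answers next to v, and untouched pieces Y.
  respondInPart : ∀ {s v u D B} (X : Structure) (Y : List Structure) →
    vertices s ↭ v ∷ vertices X ++ verticesOf Y → Adj v u → All WellFormed Y → All (Bounded B) Y →
    Response X [ u ] u D B → Response s (v ∷ u ∷ []) u D B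
  respondInPart {s} {v} {u} {D} X Y s↭ v~u wfY bY R = record
    { pieces = pieces ++ Y
    ; sub-bag = begin
        v ∷ u ∷ verticesOf (pieces ++ Y)
          ≡⟨ cong (λ xs → v ∷ u ∷ xs) (List.concatMap-++ vertices pieces Y) ⟩
        v ∷ u ∷ verticesOf pieces ++ verticesOf Y
          ≲⟨ ⊑-++⁺ˡ [ v ] (⊑-++⁺ʳ (verticesOf Y) sub-bag) ⟩
        v ∷ vertices X ++ verticesOf Y
          ≈⟨ ↭-sym s↭ ⟩
        vertices s
          ∎
    ; wellFormed = All.++⁺ wellFormed wfY
    ; bounded = All.++⁺ bounded bY
    ; covers = λ w∈ → covers′ (Perm.∈-resp-↭ s↭ w∈)
    }
    where
    open Response R
    open ⊑-Reasoning
    in-pieces : ∀ {w} → w ∈ verticesOf pieces ⊎ w ∈ verticesOf Y → w ∈ verticesOf (pieces ++ Y)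
    in-pieces w∈ = subst (_ ∈_) (sym (List.concatMap-++ vertices pieces Y))
                     ([ ∈-++⁺ˡ , ∈-++⁺ʳ (verticesOf pieces) ]′ w∈)
    covers′ : ∀ {w} → w ∈ v ∷ vertices X ++ verticesOf Y →
              Dominated (u ∷ D) w ⊎ w ∈ verticesOf (pieces ++ Y)
    covers′ (here refl) = inj₁ (adj-dominated v~u)
    covers′ (there w∈) with ∈-++⁻ (vertices X) w∈
    ... | inj₂ w∈Y = inj₂ (in-pieces (inj₂ w∈Y))
    ... | inj₁ w∈X = map₂ (in-pieces ∘ inj₁) (covers w∈X)


  private
    piecesOf : List (List V) → List Structure
    piecesOf = concatMap piece

    verticesOf-piecesOf : ∀ Cs → verticesOf (piecesOf Cs) ≡ concat Cs
    verticesOf-piecesOf [] = refl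
    verticesOf-piecesOf (C ∷ Cs) = begin
      verticesOf (piece C ++ piecesOf Cs)
        ≡⟨ List.concatMap-++ vertices (piece C) (piecesOf Cs) ⟩
      verticesOf (piece C) ++ verticesOf (piecesOf Cs)
        ≡⟨ cong₂ _++_ (verticesOf-piece C) (verticesOf-piecesOf Cs) ⟩
      C ++ concat Cs
        ∎
      where open ≡-Reasoning

    legs-empty⇒≤2 : ∀ {B legs} → 2 ≤ length legs → AllPairs (LegsBound B) legs → All (_≡ []) legs →
                    B ≤ 2
    legs-empty⇒≤2 {legs = _ ∷ []} (s≤s ()) _ _
    legs-empty⇒≤2 {legs = _ ∷ _ ∷ _} _ ((B≤ ∷ _) ∷ _) (refl ∷ refl ∷ _) = B≤

    centre-bound : ∀ {B A C} → LegsBound B A C → length A ≤ length C → B ≤ suc (length C) + suc (length C)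
    centre-bound {B} {A} {C} B≤ A≤C =
      ≤-trans B≤ (subst (2 + length A + length C ≤_) (cong suc (sym (+-suc (length C) (length C))))
                    (+-monoˡ-≤ (length C) (+-monoʳ-≤ 2 A≤C)))

    ahead-bound : ∀ {B pre v h t C} → ¬ B ≤ (2 + length t) + (2 + length t) →
                  LegsBound B (pre ++ v ∷ h ∷ t) C → LegsBound ⌈ B /2⌉ pre C
    ahead-bound {B} {pre} {v} {h} {t} {C} B≰ B≤ = m≤n+n⇒⌈m/2⌉≤n (begin
      B                                   ≤⟨ B≤′ ⟩
      2 + (p + (2 + l)) + c               ≤⟨ +-monoˡ-≤ c (+-monoʳ-≤ (2 + p) (+-monoʳ-≤ 2 l≤p+c)) ⟩
      2 + (p + (2 + (p + c))) + c         ≡⟨ rearrange p c ⟩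
      (2 + length pre + c) + (2 + length pre + c) ∎)
      where
      open ≤-Reasoning
      p = length pre
      l = length t
      c = length C
      B≤′ : B ≤ 2 + (p + (2 + l)) + c
      B≤′ = subst (λ k → B ≤ 2 + k + c) (List.length-++ pre) B≤
      rearrange : ∀ p c → 2 + (p + (2 + (p + c))) + c ≡ (2 + p + c) + (2 + p + c)
      rearrange = solve-∀
      shift : ∀ l → suc ((2 + l) + (2 + l)) ≡ (4 + l) + suc l
      shift = solve-∀
      shift′ : ∀ p l c → 2 + (p + (2 + l)) + c ≡ (4 + l) + (p + c)
      shift′ = solve-∀
      l≤p+c : l ≤ p + c
      l≤p+c = <⇒≤ (+-cancelˡ-≤ (4 + l) (suc l) (p + c)
                (subst₂ _≤_ (shift l) (shift′ p l c) (≤-trans (≰⇒> B≰) B≤′)))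

  -- Dominator takes the first vertex of a shortest nonempty leg, so every other leg keeps half of
  -- the bound as a piece of its own.
  answerAtCentre : ∀ {c legs ρ S D B} → Invariant (spider c legs ∷ ρ) S D →
                   All (Bounded B) (spider c legs ∷ ρ) → 3 ≤ B → Free G c S D → DominatorAnswers S D B c
  answerAtCentre {c} {legs} {ρ} {S} {D} {B} I (bLegs ∷ bρ) 3≤B c-free with All.head (Invariant.wellFormed I)
  ... | 2≤ , _ with shortestNonEmpty legs
  ...   | inj₁ all-empty = contradiction (legs-empty⇒≤2 2≤ bLegs all-empty) (<⇒≱ 3≤B)
  ...   | inj₂ (h , t , others , legs↭ , shorter) =
    respondInside I′ (bLegs′ ∷ bρ) c-free
      (respondInPart (spider h ([] ∷ t ∷ [])) (piecesOf others) rearranged (Linked.head lA) wfY bY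
        (claimCentre (s≤s (s≤s z≤n) , [-] ∷ Linked.tail lA ∷ [])))
    where
    I′ = rotateLegs legs↭ I
    bLegs′ = rotateLegs-bounded legs↭ bLegs
    lA = All.head (proj₂ (All.head (Invariant.wellFormed I′)))
    lOthers = All.tail (proj₂ (All.head (Invariant.wellFormed I′)))
    rearranged : c ∷ (h ∷ t) ++ concat others ↭ c ∷ (h ∷ t ++ []) ++ verticesOf (piecesOf others)
    rearranged = ↭-reflexive (cong (λ xs → c ∷ h ∷ xs)
      (cong₂ _++_ (sym (List.++-identityʳ t)) (sym (verticesOf-piecesOf others))))
    wfY : All WellFormed (piecesOf others)
    wfY = All.concat⁺ (All.map⁺ (All.tabulate λ C∈ → piece-wellFormed (All.lookup lOthers C∈)))
    bY : All (Bounded ⌈ B /2⌉) (piecesOf others)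
    bY = All.concat⁺ (All.map⁺ (All.tabulate λ {C} C∈ → piece-bounded C (bound C∈)))
      where
      bound : ∀ {C} → C ∈ others → 1 ≤ length C → B ≤ suc (length C) + suc (length C)
      bound {C} C∈ 1≤ with All.lookup shorter C∈
      ... | inj₁ refl = contradiction 1≤ λ ()
      ... | inj₂ A≤C = centre-bound {A = h ∷ t} {C} (All.lookup (AllPairs.head bLegs′) C∈) A≤C

  private
    answerBehind : ∀ {c pre v post others ρ S D B u} →
      let s = spider c ((pre ++ v ∷ post) ∷ others) in
      Invariant (s ∷ ρ) S D → All (Bounded B) (s ∷ ρ) → Free G v S D →
      (1 ≤ length post → B ≤ suc (length post) + suc (length post)) →
      Adj v u → Response (spider c (pre ∷ others)) [ u ] u D ⌈ B /2⌉ → DominatorAnswers S D B v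
    answerBehind {c} {pre} {v} {post} {others} I bounded v-free post-bound v~u R =
      respondInside I bounded v-free
        (respondInPart (spider c (pre ∷ others)) (piece post) rearranged v~u
          (piece-wellFormed (linked-++⁻ʳ (c ∷ pre) (All.head (proj₂ (All.head (Invariant.wellFormed I))))))
          (piece-bounded post post-bound) R)
      where
      rearranged : c ∷ (pre ++ v ∷ post) ++ concat others ↭
                   v ∷ (c ∷ pre ++ concat others) ++ verticesOf (piece post)
      rearranged = subst (λ xs → _ ↭ v ∷ (c ∷ pre ++ concat others) ++ xs) (sym (verticesOf-piece post))
                     (leg-split-↭ c pre v post (concat others))

    answerBehindOnLeg : ∀ {c pre v post others ρ S D B} →
      let s = spider c ((pre ++ v ∷ post) ∷ others) in
      Invariant (s ∷ ρ) S D → All (Bounded B) (s ∷ ρ) → Free G v S D →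
      (1 ≤ length post → B ≤ suc (length post) + suc (length post)) → DominatorAnswers S D B v
    answerBehindOnLeg {c} {pre} {v} {post} {others} {B = B} I bounded v-free post-bound
      with Invariant.wellFormed I | bounded | initLast pre
    ... | (2≤ , lA ∷ lOthers) ∷ _ | _ | [] =
      answerBehind I bounded v-free post-bound (adj-sym (Linked.head lA)) (claimCentre (2≤ , [-] ∷ lOthers))
    ... | (2≤ , lA ∷ lOthers) ∷ _ | (_ ∷ bOthers) ∷ _ | pre′ ∷ʳ′ p =
      answerBehind I bounded v-free post-bound (adj-sym (linked-middle (c ∷ pre′) lA′))
        (claimLegEnd (2≤ , linked-++⁻ˡ (c ∷ pre′ ∷ʳ p) lA ∷ lOthers)
                     (AllPairs.map (≤-trans (⌈n/2⌉≤n B)) bOthers))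
      where
      lA′ : Linked Adj (c ∷ pre′ ++ p ∷ v ∷ post)
      lA′ = subst (λ xs → Linked Adj (c ∷ xs)) (List.++-assoc pre′ [ p ] (v ∷ post)) lA

    answerAheadOnLeg : ∀ {c pre v h t others ρ S D B} →
      let s = spider c ((pre ++ v ∷ h ∷ t) ∷ others) in
      Invariant (s ∷ ρ) S D → All (Bounded B) (s ∷ ρ) → Free G v S D →
      ¬ B ≤ (2 + length t) + (2 + length t) → DominatorAnswers S D B v
    answerAheadOnLeg {c} {pre} {v} {h} {t} {others} {B = B} I bounded v-free B≰
      with Invariant.wellFormed I | bounded
    ... | (2≤ , lA ∷ lOthers) ∷ _ | (bA ∷ bOthers) ∷ _ =
      respondInside I bounded v-free
        (respondInPart (spider h ([] ∷ t ∷ [])) [ spider c (pre ∷ others) ] rearranged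
          (linked-middle (c ∷ pre) lA) ((2≤ , linked-++⁻ˡ (c ∷ pre) lA ∷ lOthers) ∷ [])
          ((All.map (λ {C} → ahead-bound {pre = pre} {v} {h} {t} {C} B≰) bA ∷
            AllPairs.map (≤-trans (⌈n/2⌉≤n B)) bOthers) ∷ [])
          (claimCentre (s≤s (s≤s z≤n) , [-] ∷ Linked.tail (linked-++⁻ʳ (c ∷ pre) lA) ∷ [])))
      where
      rearranged : c ∷ (pre ++ v ∷ h ∷ t) ++ concat others ↭
                   v ∷ (h ∷ t ++ []) ++ (c ∷ pre ++ concat others) ++ []
      rearranged = begin
        c ∷ (pre ++ v ∷ h ∷ t) ++ concat others
          ↭⟨ leg-split-↭ c pre v (h ∷ t) (concat others) ⟩
        v ∷ (c ∷ pre ++ concat others) ++ h ∷ t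
          ↭⟨ prep v (Perm.++-comm (c ∷ pre ++ concat others) (h ∷ t)) ⟩
        v ∷ (h ∷ t) ++ (c ∷ pre ++ concat others)
          ≡⟨ cong₂ (λ xs ys → v ∷ h ∷ xs ++ ys) (List.++-identityʳ t) (List.++-identityʳ _) ⟨
        v ∷ (h ∷ t ++ []) ++ (c ∷ pre ++ concat others) ++ []
          ∎
        where open PermutationReasoning

  -- If the part of the leg beyond v keeps half of the bound on its own, Dominator claims the neighbour
  -- of v towards the centre; otherwise he claims the neighbour beyond v.
  answerOnLeg : ∀ {c pre v post others ρ S D B} →
    let s = spider c ((pre ++ v ∷ post) ∷ others) in
    Invariant (s ∷ ρ) S D → All (Bounded B) (s ∷ ρ) → Free G v S D → DominatorAnswers S D B v
  answerOnLeg {post = []} I bounded v-free = answerBehindOnLeg I bounded v-free λ ()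
  answerOnLeg {post = h ∷ t} {B = B} I bounded v-free with B ≤? (2 + length t) + (2 + length t)
  ... | yes B≤ = answerBehindOnLeg I bounded v-free λ _ → B≤
  ... | no B≰ = answerAheadOnLeg I bounded v-free B≰

  answerInPair : ∀ {a b ρ S D B v} → Invariant (pair a b ∷ ρ) S D → All (Bounded B) (pair a b ∷ ρ) →
                 Free G v S D → v ∈ a ∷ b ∷ [] → DominatorAnswers S D B v
  answerInPair I bounded v-free (here refl) =
    respondInside I bounded v-free (claimPartner (All.head (Invariant.wellFormed I)))
  answerInPair {a} {b} I (_ ∷ bρ) v-free (there (here refl)) =
    respondInside (Invariant-resp-↭ (swap a b ↭-refl) (adj-sym a~b ∷ All.tail (Invariant.wellFormed I)) I)
      (tt ∷ bρ) v-free (claimPartner (adj-sym a~b))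
    where a~b = All.head (Invariant.wellFormed I)

  answerElsewhere : ∀ {τ S D B v} → Invariant τ S D → All (Bounded B) τ → Free G v S D →
                    v ∉ verticesOf τ → (∃ λ u → Free G u (v ∷ S) D) → DominatorAnswers S D B v
  answerElsewhere {[]} I _ (v∉S , v∉D) _ (u , u-free@(u∉vS , u∉D)) = u , u-free , [] , invariant , []
    where
    invariant : Invariant [] (_ ∷ _) (u ∷ _)
    invariant = record
      { disjoint = λ
          { (here refl) (here refl) → u∉vS (here refl)
          ; (here refl) (there v∈D) → v∉D v∈D
          ; (there x∈S) (here refl) → u∉vS (there x∈S)
          ; (there x∈S) (there x∈D) → Invariant.disjoint I x∈S x∈D }
      ; unclaimed = λ ()
      ; distinct = λ _ → z≤n
      ; wellFormed = []
      ; covers = λ w → inj₁ (weaken-dominated (dominated (Invariant.covers I w)))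
      }
      where
      dominated : ∀ {w} → Dominated _ w ⊎ w ∈ [] → Dominated _ w
      dominated (inj₁ d) = d
  answerElsewhere {pair _ _ ∷ _} I bounded v-free v∉ _ =
    respondOutside I bounded v-free v∉ (claimFirst (All.head (Invariant.wellFormed I)))
  answerElsewhere {spider _ _ ∷ _} I bounded v-free v∉ _ =
    respondOutside I bounded v-free v∉ (claimCentre (All.head (Invariant.wellFormed I)))

  answerIn : ∀ {s ρ S D B v} → Invariant (s ∷ ρ) S D → All (Bounded B) (s ∷ ρ) → 3 ≤ B →
             Free G v S D → v ∈ vertices s → DominatorAnswers S D B v
  answerIn {pair a b} I bounded _ v-free v∈ = answerInPair I bounded v-free v∈
  answerIn {spider c legs} I bounded 3≤B v-free (here refl) = answerAtCentre I bounded 3≤B v-free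
  answerIn {spider c legs} I (bLegs ∷ bρ) 3≤B v-free (there v∈) with ∈-concat⁻′ legs v∈
  ... | A , v∈A , A∈ with ∈⇒↭∷ A∈ | ∈-∃++ v∈A
  ...   | others , legs↭ | pre , post , refl =
    answerOnLeg (rotateLegs legs↭ I) (rotateLegs-bounded legs↭ bLegs ∷ bρ) v-free

  answer : ∀ {τ S D B v} → Invariant τ S D → All (Bounded B) τ → 3 ≤ B → Free G v S D →
           (∃ λ u → Free G u (v ∷ S) D) → DominatorAnswers S D B v
  answer {τ} {v = v} I bounded 3≤B v-free other with v ∈? verticesOf τ
  ... | no v∉ = answerElsewhere I bounded v-free v∉ other
  ... | yes v∈ with ∈-verticesOf⁻ τ v∈
  ...   | s , s∈ , v∈s with ∈⇒↭∷ s∈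
  ...     | ρ , τ↭ = answerIn (rotateStructures τ↭ I) (Perm.All-resp-↭ τ↭ bounded) 3≤B v-free v∈s

  lowerBound : ∀ k {τ S D B} → Invariant τ S D → All (Bounded B) τ → StallerWinsWithin G k S D →
               B ≤ 2 ^ k
  lowerBound (suc k) {B = B} I bounded (v , v-free , next) with B ≤? 2
  ... | yes B≤2 = ≤-trans B≤2 (*-monoʳ-≤ 2 (m^n>0 2 k))
  ... | no B≰2 with next
  ...   | inj₁ won = contradiction won (stallerCannotWinAtOnce I bounded (≰⇒> B≰2) (proj₂ v-free))
  ...   | inj₂ (other , continue) with answer I bounded (≰⇒> B≰2) v-free other
  ...     | u , u-free , τ , I′ , bounded′ = begin
    B                           ≤⟨ n≤⌈n/2⌉+⌈n/2⌉ B ⟩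
    ⌈ B /2⌉ + ⌈ B /2⌉           ≤⟨ +-mono-≤ ih ih ⟩
    2 ^ k + 2 ^ k               ≡⟨ cong (2 ^ k +_) (+-identityʳ (2 ^ k)) ⟨
    2 ^ suc k                   ∎
    where
    open ≤-Reasoning
    ih = lowerBound k I′ bounded′ (continue u u-free)

module StarGame (ℓ : ℕ) (n : Fin ℓ → ℕ) where

  G : Graph
  G = SubdividedStar ℓ n

  open Graph G

  _≟_ : DecidableEquality V
  centre ≟ centre = yes refl
  centre ≟ leg _ _ = no λ ()
  leg _ _ ≟ centre = no λ ()
  leg i j ≟ leg i′ j′ with i Fin.≟ i′
  ... | no i≢i′ = no λ { refl → i≢i′ refl }
  ... | yes refl with j Fin.≟ j′
  ...   | yes refl = yes refl
  ...   | no j≢j′ = no λ { refl → j≢j′ refl }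

  adj-sym : ∀ {a b} → Adj a b → Adj b a
  adj-sym (cx i j j≡0) = xc i j j≡0
  adj-sym (xc i j j≡0) = cx i j j≡0
  adj-sym (up i j j′ j′≡) = dn i j j′ j′≡
  adj-sym (dn i j j′ j′≡) = up i j j′ j′≡

  adj-irrefl : ∀ {a} → ¬ Adj a a
  adj-irrefl (up _ _ _ j≡suc-j) = <-irrefl j≡suc-j (n<1+n _)
  adj-irrefl (dn _ _ _ j≡suc-j) = <-irrefl j≡suc-j (n<1+n _)

  open DominatorStrategy G _≟_ adj-sym adj-irrefl public
  open Bags _≟_

  legVertices : Fin ℓ → List V
  legVertices i = tabulate (leg i)

  length-legVertices : ∀ i → length (legVertices i) ≡ n i
  length-legVertices i = List.length-tabulate {n = n i} (leg i)

  legs : List (List V)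
  legs = tabulate legVertices

  legs-linked : All (λ A → Linked Adj (centre ∷ A)) legs
  legs-linked = All.tabulate⁺ λ i → ∷-tabulate-linked centre (leg i) (cx i) (up i)

  all-vertices-unique : Unique (centre ∷ concat legs)
  all-vertices-unique =
    All.tabulate centre∉ ∷
    Unique.concat⁺ (All.tabulate⁺ λ _ → Unique.tabulate⁺ leg-injective) (AllPairs.tabulate⁺ disjoint)
    where
    leg-injective : ∀ {i} {j j′ : Fin (n i)} → leg i j ≡ leg i j′ → j ≡ j′
    leg-injective refl = refl
    centre∉ : ∀ {w} → w ∈ concat legs → centre ≢ w
    centre∉ w∈ refl with ∈-concat⁻′ legs w∈
    ... | A , c∈A , A∈ with ∈-tabulate⁻ A∈
    ...   | i , refl with ∈-tabulate⁻ c∈A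
    ...     | j , ()
    disjoint : ∀ {i i′} → i ≢ i′ → Disjoint (legVertices i) (legVertices i′)
    disjoint i≢i′ (w∈ , w∈′) with ∈-tabulate⁻ w∈ | ∈-tabulate⁻ w∈′
    ... | j , refl | j′ , refl = i≢i′ refl

  odd-length? : ∀ (A : List V) → Dec (Odd (length A))
  odd-length? A = odd? (length A)

  oddLegs evenLegs : List (List V)
  oddLegs = filter odd-length? legs
  evenLegs = filter (∁? odd-length?) legs

  initial : List Structure
  initial = spider centre oddLegs ∷ concatMap pairUp evenLegs

  initial-⊑ : verticesOf initial ⊑ centre ∷ concat legs
  initial-⊑ = begin
    centre ∷ concat oddLegs ++ verticesOf (concatMap pairUp evenLegs)
      ≲⟨ ⊑-++⁺ˡ (centre ∷ concat oddLegs) (concatMap-pairUp-⊑ (λ A → A) (λ _ → ↭-refl) evenLegs) ⟩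
    centre ∷ concat oddLegs ++ concat evenLegs
      ≡⟨ cong (centre ∷_) (List.concat-++ oddLegs evenLegs) ⟩
    centre ∷ concat (oddLegs ++ evenLegs)
      ≈⟨ prep centre (concat-↭ (filter-partition-↭ odd-length? legs)) ⟩
    centre ∷ concat legs
      ∎
    where open ⊑-Reasoning

  initial-covers : ∀ w → w ∈ verticesOf initial
  initial-covers centre = here refl
  initial-covers (leg i j) with parity (n i)
  ... | inj₂ odd =
    there (∈-++⁺ˡ (∈-concat⁺′ (∈-tabulate⁺ j) (∈-filter⁺ odd-length? (∈-tabulate⁺ i) odd′)))
    where odd′ = subst Odd (sym (length-legVertices i)) odd
  ... | inj₁ (k , even) = ∈-++⁺ʳ (centre ∷ concat oddLegs)
        (∈-verticesOf-concatMap pairUp (∈-filter⁺ (∁? odd-length?) (∈-tabulate⁺ i) not-odd)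
          (pairUp-covers-even (legVertices i) k (trans (length-legVertices i) even) (∈-tabulate⁺ j)))
    where
    not-odd : ¬ Odd (length (legVertices i))
    not-odd (k′ , odd) = even≢odd k k′ (trans (sym even) (trans (sym (length-legVertices i)) odd))

  module ShortestOddLegs (i₁ i₂ : Fin ℓ) (i₁≢i₂ : i₁ ≢ i₂)
      (odd₁ : Odd (n i₁)) (odd₂ : Odd (n i₂))
      (min₁ : ∀ k → Odd (n k) → k ≢ i₁ → k ≢ i₂ → n i₁ ≤ n k)
      (min₂ : ∀ k → Odd (n k) → k ≢ i₁ → k ≢ i₂ → n i₂ ≤ n k) where

    B₀ : ℕ
    B₀ = 2 + (n i₁ + n i₂)

    atLeast₁ : ∀ {k} → k ≢ i₂ → Odd (n k) → n i₁ ≤ n k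
    atLeast₁ {k} k≢i₂ odd with k Fin.≟ i₁
    ... | yes refl = ≤-refl
    ... | no k≢i₁ = min₁ k odd k≢i₁ k≢i₂

    atLeast₂ : ∀ {k} → k ≢ i₁ → Odd (n k) → n i₂ ≤ n k
    atLeast₂ {k} k≢i₁ odd with k Fin.≟ i₂
    ... | yes refl = ≤-refl
    ... | no k≢i₂ = min₂ k odd k≢i₁ k≢i₂

    shortest-pair : ∀ {i j} → i ≢ j → Odd (n i) → Odd (n j) → n i₁ + n i₂ ≤ n i + n j
    shortest-pair {i} {j} i≢j odd-i odd-j with i Fin.≟ i₁ | j Fin.≟ i₂
    ... | yes refl | _ = +-monoʳ-≤ (n i₁) (atLeast₂ (i≢j ∘ sym) odd-j)
    ... | no i≢i₁ | yes refl = +-monoˡ-≤ (n i₂) (atLeast₁ i≢j odd-i)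
    ... | no i≢i₁ | no j≢i₂ =
      subst (n i₁ + n i₂ ≤_) (+-comm (n j) (n i))
            (+-mono-≤ (atLeast₁ j≢i₂ odd-j) (atLeast₂ i≢i₁ odd-i))

    initial-bounded : All (Bounded B₀) initial
    initial-bounded = AllPairs-filter odd-length? (AllPairs.tabulate⁺ legs-bound) ∷ pairs-bounded
      where
      legs-bound : ∀ {i j} → i ≢ j → Odd (length (legVertices i)) → Odd (length (legVertices j)) →
                   LegsBound B₀ (legVertices i) (legVertices j)
      legs-bound {i} {j} i≢j odd-i odd-j
        rewrite length-legVertices i | length-legVertices j = +-monoʳ-≤ 2 (shortest-pair i≢j odd-i odd-j)
      pairs-bounded : All (Bounded B₀) (concatMap pairUp evenLegs)
      pairs-bounded = All.concat⁺ (All.map⁺ {xs = evenLegs} (All.tabulate λ {A} _ → pairUp-bounded A))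

    two-odd-legs : 2 ≤ length oddLegs
    two-odd-legs = two-members (odd-leg odd₁) (odd-leg odd₂) legs-differ
      where
      odd-leg : ∀ {i} → Odd (n i) → legVertices i ∈ oddLegs
      odd-leg {i} odd = ∈-filter⁺ odd-length? (∈-tabulate⁺ i) (subst Odd (sym (length-legVertices i)) odd)
      first : Fin (n i₁)
      first = fromℕ< (subst (0 <_) (sym (proj₂ odd₁)) (s≤s z≤n))
      legs-differ : legVertices i₁ ≢ legVertices i₂
      legs-differ eq with ∈-tabulate⁻ (subst (leg i₁ first ∈_) eq (∈-tabulate⁺ first))
      ... | _ , refl = i₁≢i₂ refl

    initial-invariant : Invariant initial [] []
    initial-invariant = record
      { disjoint = λ ()
      ; unclaimed = λ _ → (λ ()) , (λ ())
      ; distinct = Distinct-⊑ initial-⊑ (Unique⇒Distinct all-vertices-unique)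
      ; wellFormed = (two-odd-legs , All.filter⁺ odd-length? legs-linked) ∷ pairs-wellFormed
      ; covers = λ w → inj₂ (initial-covers w)
      }
      where
      pairs-wellFormed : All WellFormed (concatMap pairUp evenLegs)
      pairs-wellFormed = All.concat⁺ (All.map⁺ {xs = evenLegs} (All.tabulate λ A∈ →
        pairUp-wellFormed (Linked.tail (All.lookup legs-linked (proj₁ (∈-filter⁻ (∁? odd-length?) A∈))))))

  module PathThroughCentre (i₁ i₂ : Fin ℓ) (i₁≢i₂ : i₁ ≢ i₂) (odd₁ : Odd (n i₁)) where

    n₁ n₂ N : ℕ
    n₁ = n i₁
    n₂ = n i₂
    N = n₁ + n₂ + 1

    N≡1+n₁+n₂ : N ≡ suc (n₁ + n₂)
    N≡1+n₁+n₂ = +-comm (n₁ + n₂) 1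

    -- Positions 0 … n₁ - 1 run along leg i₁ towards the centre at position n₁, then along leg i₂;
    -- positions from N on are junk.
    beyondCentre : ℕ → V
    beyondCentre zero = centre
    beyondCentre (suc j) with j <? n₂
    ... | yes j<n₂ = leg i₂ (fromℕ< j<n₂)
    ... | no _ = centre

    path : ℕ → V
    path p with p <? n₁
    ... | yes p<n₁ = leg i₁ (opposite (fromℕ< p<n₁))
    ... | no _ = beyondCentre (p ∸ n₁)

    data Position : ℕ → Set where
      on-leg₁   : (j : Fin n₁) → Position (toℕ (opposite j))
      at-centre : Position n₁
      on-leg₂   : (j : Fin n₂) → Position (suc (n₁ + toℕ j))

    position : ∀ {p} → p < N → Position p
    position {p} p<N with p <? n₁
    ... | yes p<n₁ = subst Position (trans (cong toℕ (Fin.opposite-involutive _)) (Fin.toℕ-fromℕ< p<n₁))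
                       (on-leg₁ (opposite (fromℕ< p<n₁)))
    ... | no p≮n₁ with p ∸ n₁ | m+[n∸m]≡n (≮⇒≥ p≮n₁)
    ...   | zero | n₁+0≡p = subst Position (trans (sym (+-identityʳ n₁)) n₁+0≡p) at-centre
    ...   | suc d | n₁+d+1≡p = subst Position (trans (cong (λ k → suc (n₁ + k)) (Fin.toℕ-fromℕ< d<n₂))
                                  (trans (sym (+-suc n₁ d)) n₁+d+1≡p)) (on-leg₂ (fromℕ< d<n₂))
      where
      d<n₂ : d < n₂
      d<n₂ = +-cancelˡ-≤ n₁ (suc d) n₂ (≤-pred (subst₂ _<_ (sym n₁+d+1≡p) N≡1+n₁+n₂ p<N))

    vertexAt : ∀ {p} → Position p → V
    vertexAt (on-leg₁ j) = leg i₁ j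
    vertexAt at-centre = centre
    vertexAt (on-leg₂ j) = leg i₂ j

    path-position : ∀ {p} (pos : Position p) → path p ≡ vertexAt pos
    path-position (on-leg₁ j) with toℕ (opposite j) <? n₁
    ... | yes p<n₁ =
      cong (leg i₁) (trans (cong opposite (Fin.fromℕ<-toℕ (opposite j) p<n₁)) (Fin.opposite-involutive j))
    ... | no p≮n₁ = contradiction (Fin.toℕ<n (opposite j)) p≮n₁
    path-position at-centre with n₁ <? n₁
    ... | yes n₁<n₁ = contradiction n₁<n₁ (<-irrefl refl)
    ... | no _ = cong beyondCentre (n∸n≡0 n₁)
    path-position (on-leg₂ j) with suc (n₁ + toℕ j) <? n₁
    ... | yes p<n₁ = contradiction (≤-trans (s≤s (m≤m+n n₁ (toℕ j))) (<⇒≤ p<n₁)) (<-irrefl refl)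
    ... | no _ = trans (cong beyondCentre offset) beyond
      where
      offset : suc (n₁ + toℕ j) ∸ n₁ ≡ suc (toℕ j)
      offset = trans (cong (_∸ n₁) (sym (+-suc n₁ (toℕ j)))) (m+n∸m≡n n₁ (suc (toℕ j)))
      beyond : beyondCentre (suc (toℕ j)) ≡ leg i₂ j
      beyond with toℕ j <? n₂
      ... | yes j<n₂ = cong (leg i₂) (Fin.fromℕ<-toℕ j j<n₂)
      ... | no j≮n₂ = contradiction (Fin.toℕ<n j) j≮n₂

    index : V → ℕ
    index centre = n₁
    index (leg i j) with i Fin.≟ i₁ | i Fin.≟ i₂
    ... | yes refl | _ = toℕ (opposite j)
    ... | no _ | yes refl = suc (n₁ + toℕ j)
    ... | no _ | no _ = 0

    index-vertexAt : ∀ {p} (pos : Position p) → index (vertexAt pos) ≡ p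
    index-vertexAt (on-leg₁ j) with i₁ Fin.≟ i₁
    ... | yes refl = refl
    ... | no i₁≢i₁ = contradiction refl i₁≢i₁
    index-vertexAt at-centre = refl
    index-vertexAt (on-leg₂ j) with i₂ Fin.≟ i₁ | i₂ Fin.≟ i₂
    ... | yes i₂≡i₁ | _ = contradiction (sym i₂≡i₁) i₁≢i₂
    ... | no _ | yes refl = refl
    ... | no _ | no i₂≢i₂ = contradiction refl i₂≢i₂

    path-injective : ∀ {p q} → p < N → q < N → path p ≡ path q → p ≡ q
    path-injective {p} {q} p<N q<N eq = begin
      p                            ≡⟨ index-vertexAt (position p<N) ⟨
      index (vertexAt (position p<N)) ≡⟨ cong index (path-position (position p<N)) ⟨
      index (path p)               ≡⟨ cong index eq ⟩
      index (path q)               ≡⟨ cong index (path-position (position q<N)) ⟩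
      index (vertexAt (position q<N)) ≡⟨ index-vertexAt (position q<N) ⟩
      q                            ∎
      where open ≡-Reasoning

    position<N : ∀ {p} → Position p → p < N
    position<N (on-leg₁ j) = <-trans (Fin.toℕ<n (opposite j)) (position<N at-centre)
    position<N at-centre = subst (n₁ <_) (sym N≡1+n₁+n₂) (s≤s (m≤m+n n₁ n₂))
    position<N (on-leg₂ j) = subst (suc (n₁ + toℕ j) <_) (sym N≡1+n₁+n₂) (s≤s (+-monoʳ-< n₁ (Fin.toℕ<n j)))

    leg-neighbour : ∀ {p u} (pos : Position p) → p ≢ n₁ → Adj (vertexAt pos) u →
                    ∃ λ q → ∃ λ (posq : Position q) → (suc q ≡ p ⊎ q ≡ suc p) × u ≡ vertexAt posq
    leg-neighbour at-centre p≢n₁ _ = contradiction refl p≢n₁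
    leg-neighbour (on-leg₁ j) _ (xc _ _ j≡0) =
      n₁ , at-centre , inj₂ (trans (sym (opposite+suc j)) (trans (cong (λ k → o + suc k) j≡0) (+-comm o 1))) , refl
      where o = toℕ (opposite j)
    leg-neighbour (on-leg₁ j) _ (up _ _ j′ j′≡) = _ , on-leg₁ j′ , inj₁ (suc-opposite j′≡) , refl
    leg-neighbour (on-leg₁ j) _ (dn _ k _ j≡) = _ , on-leg₁ k , inj₂ (sym (suc-opposite j≡)) , refl
    leg-neighbour (on-leg₂ j) _ (xc _ _ j≡0) =
      n₁ , at-centre , inj₁ (cong suc (trans (sym (+-identityʳ n₁)) (cong (n₁ +_) (sym j≡0)))) , refl
    leg-neighbour (on-leg₂ j) _ (up _ _ j′ j′≡) =
      _ , on-leg₂ j′ , inj₂ (cong suc (trans (cong (n₁ +_) j′≡) (+-suc n₁ (toℕ j)))) , refl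
    leg-neighbour (on-leg₂ j) _ (dn _ k _ j≡) =
      _ , on-leg₂ k , inj₁ (cong suc (trans (sym (+-suc n₁ (toℕ k))) (cong (n₁ +_) (sym j≡)))) , refl

    even-closed : ∀ e {u} → 2 * e < N → InClosedNbhd G (path (2 * e)) u →
                  ∃ λ q → q < N × (q ≡ 2 * e ⊎ suc q ≡ 2 * e ⊎ q ≡ suc (2 * e)) × u ≡ path q
    even-closed e p<N (inj₁ refl) = 2 * e , p<N , inj₁ refl , refl
    even-closed e p<N (inj₂ adj)
      with leg-neighbour (position p<N) not-centre (subst (λ x → Adj x _) (path-position (position p<N)) adj)
      where
      not-centre : 2 * e ≢ n₁
      not-centre eq = even≢odd e (proj₁ odd₁) (trans eq (proj₂ odd₁))
    ... | q , posq , near , refl = q , position<N posq , inj₂ near , sym (path-position posq)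

    open StallerStrategy G _≟_ N path path-injective even-closed public

theorem18 : (ℓ : ℕ) → 2 ≤ ℓ → (n : Fin ℓ → ℕ) → (∀ i → 1 ≤ n i) →
    (i₁ i₂ : Fin ℓ) → i₁ ≢ i₂ → Odd (n i₁) → Odd (n i₂) →
    (∀ k → Odd (n k) → k ≢ i₁ → k ≢ i₂ → n i₁ ≤ n k) →
    (∀ k → Odd (n k) → k ≢ i₁ → k ≢ i₂ → n i₂ ≤ n k) →
    γ'SMB≡ (SubdividedStar ℓ n) ⌈log₂ (n i₁ + n i₂ + 1) ⌉
theorem18 ℓ _ n _ i₁ i₂ i₁≢i₂ odd₁@(a , n₁≡) odd₂@(b , n₂≡) min₁ min₂ =
  stallerWinsFast , noFaster
  where
  open StarGame ℓ n
  open ShortestOddLegs i₁ i₂ i₁≢i₂ odd₁ odd₂ min₁ min₂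
  open PathThroughCentre i₁ i₂ i₁≢i₂ odd₁

  N≡2r+1 : n i₁ + n i₂ + 1 ≡ suc (2 * suc (a + b))
  N≡2r+1 rewrite n₁≡ | n₂≡ = sum-of-odds a b
    where
    sum-of-odds : ∀ a b → suc (2 * a) + suc (2 * b) + 1 ≡ suc (2 * suc (a + b))
    sum-of-odds = solve-∀

  N≤B₀ : N ≤ B₀
  N≤B₀ = ≤-trans (≤-reflexive N≡1+n₁+n₂) (n≤1+n _)

  stallerWinsFast : StallerWinsWithin G ⌈log₂ N ⌉ [] []
  stallerWinsFast with ⌈log₂⌉-odd N≡2r+1 (s≤s z≤n)
  ... | j , log≡ , r<2^j = subst (λ c → StallerWinsWithin G c [] []) (sym log≡) (stallerWins N≡2r+1 r<2^j)

  noFaster : ∀ k → StallerWinsWithin G k [] [] → ⌈log₂ N ⌉ ≤ k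
  noFaster k win = subst (⌈log₂ N ⌉ ≤_) (⌈log₂2^n⌉≡n k)
    (⌈log₂⌉-mono-≤ (≤-trans N≤B₀ (lowerBound k initial-invariant initial-bounded win)))
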